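{- The class $\mathcal{M}_v(\Phi_{Y_1})$ is exactly the class of binary matroids having an even-cycle representation with a blocking pair. Moreover, this class is minor-closed.
   Context: The class $\mathcal{M}_v(\Phi_{Y_1})$ (matroids virtually conforming to the template $\Phi_{Y_1}$) is the class of all matroids isomorphic to the column matroid $M(A)$ of a matrix $A$ over $\mathrm{GF}(2)$ whose rows are indexed by $\{x_1,x_2\}\cup R$ for some finite set $R$, such that every column of $A$ is of one of the following two kinds: (a) its entries in rows $x_1,x_2$ are both $0$ and it has at most two nonzero entries in rows $R$; or (b) its entries in rows $(x_1,x_2)$ are $(1,0)$, $(0,1)$ or $(1,1)$ and it has at most one nonzero entry in rows $R$. An even-cycle matroid is a binary matroid of the form $M\binom{w}{D}$ (column matroid of the matrix $D$ with an extra row $w$ on top), where $D\in\mathrm{GF}(2)^{V\times E}$ is the vertex-edge incidence matrix of a graph $G=(V,E)$ (a loop giving a zero column) and $w\in\mathrm{GF}(2)^E$ is the characteristic vector of a set $W\subseteq E$; the pair $(G,W)$ is an even-cycle representation of $M$. Edges in $W$ are odd. An odd cycle of $(G,W)$ is a cycle of $G$ containing an odd number of odd edges. A blocking pair of $(G,W)$ is a pair of vertices $u,v$ of $G$ such that every odd cycle passes through at least one of $u,v$. -}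

module Defs where

open import Data.Nat using (ℕ; zero; suc; _+_; _<_; _≤_; _%_)
open import Data.Bool using (Bool; true; false; _xor_; _∧_; not; if_then_else_)
open import Data.Fin using (Fin; zero; suc; inject₁; fromℕ; _≟_)
open import Data.Fin.Subset using (Subset; _∈_; _∉_; _⊆_; ⁅_⁆; _∪_; _∩_; ∣_∣; inside; outside)
  renaming (⊥ to ∅)
open import Data.Fin.Permutation using (Permutation′; _⟨$⟩ˡ_)
open import Data.Vec using (Vec; tabulate; lookup)
open import Data.Product using (Σ; ∃; ∃-syntax; _×_; _,_)
open import Data.Sum using (_⊎_)
open import Relation.Binary.PropositionalEquality using (_≡_; _≢_)
open import Relation.Nullary using (¬_; does)
open import Function using (_⇔_)

record Matroid (n : ℕ) : Set₁ where
  field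
    Indep       : Subset n → Set
    indep-∅     : Indep ∅
    indep-⊆     : ∀ {X Y} → Y ⊆ X → Indep X → Indep Y
    indep-aug   : ∀ {X Y} → Indep X → Indep Y → ∣ X ∣ < ∣ Y ∣ →
                  ∃[ e ] (e ∈ Y × e ∉ X × Indep (⁅ e ⁆ ∪ X))
open Matroid public

-- Matrices over GF(2) (GF(2) = Bool with xor as addition, ∧ as product).

Matrix : ℕ → ℕ → Set
Matrix r n = Fin r → Fin n → Bool

Σ₂ : ∀ {n} → (Fin n → Bool) → Bool
Σ₂ {zero}  f = false
Σ₂ {suc n} f = f zero xor Σ₂ (λ j → f (suc j))

colSum : ∀ {r n} → Matrix r n → Subset n → Fin r → Bool
colSum A Y i = Σ₂ (λ j → lookup Y j ∧ A i j)

LinIndep : ∀ {r n} → Matrix r n → Subset n → Set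
LinIndep A X = ∀ Y → Y ⊆ X → (∀ i → colSum A Y i ≡ false) → Y ≡ ∅

image : ∀ {n} → Permutation′ n → Subset n → Subset n
image π X = tabulate (λ j → lookup X (π ⟨$⟩ˡ j))

IsoToColumnMatroid : ∀ {n r} → Matroid n → Matrix r n → Set
IsoToColumnMatroid {n} M A =
  Σ (Permutation′ n) λ π → ∀ X → Indep M X ⇔ LinIndep A (image π X)

IsBinary : ∀ {n} → Matroid n → Set
IsBinary {n} M = ∃[ r ] Σ (Matrix r n) λ A → IsoToColumnMatroid M A

-- The template Φ_{Y1}.  Rows are Fin (2 + r): row 0 is x₁, row 1 is x₂,
-- rows suc (suc i) form R = Fin r.

weightR : ∀ {r n} → Matrix (2 + r) n → Fin n → ℕ
weightR A j = ∣ tabulate (λ i → A (suc (suc i)) j) ∣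

ColumnKindA : ∀ {r n} → Matrix (2 + r) n → Fin n → Set
ColumnKindA A j = A zero j ≡ false × A (suc zero) j ≡ false × weightR A j ≤ 2

ColumnKindB : ∀ {r n} → Matrix (2 + r) n → Fin n → Set
ColumnKindB A j =
  ((A zero j ≡ true × A (suc zero) j ≡ false) ⊎
   (A zero j ≡ false × A (suc zero) j ≡ true) ⊎
   (A zero j ≡ true × A (suc zero) j ≡ true))
  × weightR A j ≤ 1

ConformsΦY1 : ∀ {r n} → Matrix (2 + r) n → Set
ConformsΦY1 A = ∀ j → ColumnKindA A j ⊎ ColumnKindB A j

InMvΦY1 : ∀ {n} → Matroid n → Set
InMvΦY1 {n} M = ∃[ r ] Σ (Matrix (2 + r) n) λ A → ConformsΦY1 A × IsoToColumnMatroid M A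

record Graph (v n : ℕ) : Set where
  field
    end₁ end₂ : Fin n → Fin v
open Graph public

-- vertex-edge incidence matrix over GF(2); a loop gives a zero column
incidence : ∀ {v n} → Graph v n → Matrix v n
incidence G x e = does (x ≟ end₁ G e) xor does (x ≟ end₂ G e)

ecMatrix : ∀ {v n} → Graph v n → Subset n → Matrix (suc v) n
ecMatrix G W zero    e = lookup W e
ecMatrix G W (suc x) e = incidence G x e

Joins : ∀ {v n} → Graph v n → Fin n → Fin v → Fin v → Set
Joins G e a b = (end₁ G e ≡ a × end₂ G e ≡ b) ⊎ (end₁ G e ≡ b × end₂ G e ≡ a)

-- a cycle of length k+1: distinct vertices vs 0..k, distinct edges es 0..k,
-- es i joins vs i and vs (i+1), es k joins vs k and vs 0
-- (k = 0: a loop; k = 1: two parallel edges)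
record Cycle {v n} (G : Graph v n) : Set where
  field
    len    : ℕ
    vs     : Fin (suc len) → Fin v
    es     : Fin (suc len) → Fin n
    vs-inj : ∀ i j → vs i ≡ vs j → i ≡ j
    es-inj : ∀ i j → es i ≡ es j → i ≡ j
    step   : ∀ (i : Fin len) → Joins G (es (inject₁ i)) (vs (inject₁ i)) (vs (suc i))
    close  : Joins G (es (fromℕ len)) (vs (fromℕ len)) (vs zero)
open Cycle public

OddCycle : ∀ {v n} (G : Graph v n) → Subset n → Cycle G → Set
OddCycle G W C = ∣ tabulate (λ i → lookup W (es C i)) ∣ % 2 ≡ 1

PassesThrough : ∀ {v n} {G : Graph v n} → Cycle G → Fin v → Set
PassesThrough C x = ∃[ i ] vs C i ≡ x

IsBlockingPair : ∀ {v n} (G : Graph v n) → Subset n → Fin v → Fin v → Set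
IsBlockingPair G W a b =
  a ≢ b × (∀ (C : Cycle G) → OddCycle G W C → PassesThrough C a ⊎ PassesThrough C b)

HasECRWithBlockingPair : ∀ {n} → Matroid n → Set
HasECRWithBlockingPair {n} M =
  ∃[ v ] Σ (Graph v n) λ G → Σ (Subset n) λ W →
    (∃[ a ] ∃[ b ] IsBlockingPair G W a b) × IsoToColumnMatroid M (ecMatrix G W)

-- Minors: N is (isomorphic to) M / C \ D, where C, D are disjoint,
-- φ : E(N) → E(M) is a bijection onto E(M) - (C ∪ D), and independence in
-- M / C \ D is: I ∪ B independent in M, for a basis B of M|C.

IsImage : ∀ {m n} → (Fin m → Fin n) → Subset m → Subset n → Set
IsImage φ X Y = ∀ e → e ∈ Y ⇔ (∃[ x ] (x ∈ X × φ x ≡ e))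

IsBasisOf : ∀ {n} → Matroid n → Subset n → Subset n → Set
IsBasisOf M C B = B ⊆ C × Indep M B × (∀ e → e ∈ C → e ∉ B → ¬ Indep M (⁅ e ⁆ ∪ B))

IsMinorOf : ∀ {m n} → Matroid m → Matroid n → Set
IsMinorOf {m} {n} N M =
  Σ (Subset n) λ C → Σ (Subset n) λ D → Σ (Fin m → Fin n) λ φ → Σ (Subset n) λ B →
    C ∩ D ≡ ∅ ×
    (∀ x y → φ x ≡ φ y → x ≡ y) ×
    (∀ e → (∃[ x ] φ x ≡ e) ⇔ (e ∉ C × e ∉ D)) ×
    IsBasisOf M C B ×
    (∀ X Y → IsImage φ X Y → (Indep N X ⇔ Indep M (Y ∪ B)))

-- A template matrix is the incidence matrix of a graph in disguise: take a vertex x for the row x₂,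
-- a vertex y for the row x₂ + Σ R, and one vertex per row of R.  A column with two R-entries is then
-- an edge between R-vertices and a column with at most one R-entry an edge at x or y.  Row x₁ marks
-- the odd edges, which are columns of the second kind, so {x, y} is a blocking pair.
-- Conversely, if {a, b} blocks every odd cycle, the graph G − a − b has no odd cycle, so W agrees on it
-- with the cut δ(s) of a vertex signing s (built edge by edge, an offending edge closing an odd cycle).
-- Then W + δ(s) only meets edges at a or b, and the rows W + δ(s), a, and the other vertices form a
-- template matrix with the same kernel as the even-cycle matrix.
-- Contracting an element is a pivot on a nonzero entry of its column, and choosing the pivot row
-- well (in R if possible) keeps every column in template form; deleting elements drops columns.

module Submission where

open import Defs
open import Data.Nat using (ℕ; zero; suc; _+_; _<_; _≤_; _%_; z≤n; s≤s)
open import Data.Nat.Properties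
  using (≤⇒≯; ≤-pred; ≤-refl; <-irrefl; <⇒≤; m<n⇒m<1+n; m<1+n⇒m<n∨m≡n)
open import Data.Bool using (Bool; true; false; _xor_; _∧_; _∨_; not; if_then_else_)
open import Data.Bool.Properties
  using ( xor-assoc; xor-comm; xor-identityʳ; xor-same; ∧-zeroʳ; ∧-assoc; ∧-comm; ∧-identityʳ
        ; ∧-distribˡ-xor; ∧-distribʳ-xor; ¬-not; not-involutive; ∨-identityʳ; ∨-zeroʳ)
import Data.Bool.Properties as Bool
open import Data.Bool.Solver using (module xor-∧-Solver)
open import Data.Fin using (Fin; zero; suc; _≟_; toℕ; inject₁; fromℕ; fromℕ<)
open import Data.Fin.Properties using (any?; toℕ-injective; toℕ<n; toℕ-fromℕ<)
open import Data.Fin.Subset using (Subset; _∈_; _∪_; ∣_∣) renaming (⊥ to ∅)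
open import Data.Fin.Permutation using (_⟨$⟩ˡ_; _⟨$⟩ʳ_; inverseˡ; inverseʳ) renaming (id to idₚ)
open import Data.Vec using (Vec; tabulate; lookup)
open import Data.Vec.Properties
  using (lookup∘tabulate; tabulate∘lookup; tabulate-cong; lookup-replicate; lookup-zipWith; []=⇒lookup; lookup⇒[]=)
open import Data.List using (List; []; _∷_; _++_; length)
open import Data.List.Relation.Unary.All using (All; []; _∷_) renaming (map to All-map; lookup to All-lookup)
import Data.List.Relation.Unary.All.Properties as All
open import Data.List.Relation.Unary.AllPairs using ([]; _∷_)
open import Data.List.Relation.Unary.Unique.Propositional using (Unique)
import Data.List.Relation.Unary.Unique.Propositional.Properties as Unique
open import Data.List.Relation.Unary.Any using (here; there)
open import Data.List.Membership.Propositional using () renaming (_∈_ to _∈ˡ_)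
open import Data.Product using (Σ; ∃-syntax; _×_; _,_; proj₁; proj₂)
open import Data.Sum using (_⊎_; inj₁; inj₂; [_,_]′)
import Data.Sum as Sum
open import Data.Empty using (⊥; ⊥-elim)
open import Relation.Binary.PropositionalEquality
open import Relation.Nullary using (¬_; Dec; does; yes; no; ¬?; _×-dec_; contradiction)
open import Relation.Nullary.Decidable using (dec-true; dec-false)
open import Function using (id; _∘_; case_of_; _⇔_; mk⇔)
open import Function.Bundles using (Equivalence)
open import Function.Definitions using (Injective)
import Function.Properties.Equivalence as ⇔

open xor-∧-Solver using (solve; _:=_; _:+_; _:*_)

-- Booleans and sums over GF(2)

infix 4 _≡ᵇ_

_≡ᵇ_ : ∀ {n} → Fin n → Fin n → Bool
x ≡ᵇ y = does (x ≟ y)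

≡ᵇ-refl : ∀ {n} (x : Fin n) → (x ≡ᵇ x) ≡ true
≡ᵇ-refl x = dec-true (x ≟ x) refl

≢⇒≡ᵇ-false : ∀ {n} {x y : Fin n} → x ≢ y → (x ≡ᵇ y) ≡ false
≢⇒≡ᵇ-false {x = x} {y} = dec-false (x ≟ y)

≡ᵇ⇒≡ : ∀ {n} {x y : Fin n} → (x ≡ᵇ y) ≡ true → x ≡ y
≡ᵇ⇒≡ {x = x} {y} e with x ≟ y
... | yes x≡y = x≡y

≡⇒≡ᵇ : ∀ {n} {x y : Fin n} → x ≡ y → (x ≡ᵇ y) ≡ true
≡⇒≡ᵇ {x = x} refl = ≡ᵇ-refl x

≡ᵇ-false⇒≢ : ∀ {n} {x y : Fin n} → (x ≡ᵇ y) ≡ false → x ≢ y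
≡ᵇ-false⇒≢ {x = x} {y} e with x ≟ y
... | no x≢y = x≢y

≡ᵇ-sym : ∀ {n} (x y : Fin n) → (x ≡ᵇ y) ≡ (y ≡ᵇ x)
≡ᵇ-sym x y with x ≟ y | y ≟ x
... | yes _   | yes _   = refl
... | no _    | no _    = refl
... | yes x≡y | no y≢x  = ⊥-elim (y≢x (sym x≡y))
... | no x≢y  | yes y≡x = ⊥-elim (x≢y (sym y≡x))

≢true⇒≡false : ∀ {b} → b ≢ true → b ≡ false
≢true⇒≡false = ¬-not

true≢false : true ≢ false
true≢false ()

≢⇒xor≡true : ∀ {x y} → x ≢ y → x xor y ≡ true
≢⇒xor≡true {true}  {true}  x≢y = ⊥-elim (x≢y refl)
≢⇒xor≡true {true}  {false} _   = refl
≢⇒xor≡true {false} {true}  _   = refl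
≢⇒xor≡true {false} {false} x≢y = ⊥-elim (x≢y refl)

xor≡true⁻ : ∀ {x y} → x xor y ≡ true → x ≡ true ⊎ y ≡ true
xor≡true⁻ {true}  _ = inj₁ refl
xor≡true⁻ {false} e = inj₂ e

xor≡false⇒≡ : ∀ {x y} → x xor y ≡ false → x ≡ y
xor≡false⇒≡ {true}  {true}  _ = refl
xor≡false⇒≡ {false} {false} _ = refl

Bool-cases : ∀ {ℓ} {P : Set ℓ} (b : Bool) → (b ≡ true → P) → (b ≡ false → P) → P
Bool-cases true  t f = t refl
Bool-cases false t f = f refl

true-or-all-false : ∀ {n} (f : Fin n → Bool) → (∃[ j ] f j ≡ true) ⊎ (∀ j → f j ≡ false)
true-or-all-false f with any? (λ j → f j Bool.≟ true)
... | yes ∃j = inj₁ ∃j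
... | no ∄j  = inj₂ λ j → ¬-not λ fj → ∄j (j , fj)

Σ₂-cong : ∀ {n} {f g : Fin n → Bool} → (∀ j → f j ≡ g j) → Σ₂ f ≡ Σ₂ g
Σ₂-cong {zero}  f≗g = refl
Σ₂-cong {suc n} f≗g = cong₂ _xor_ (f≗g zero) (Σ₂-cong (f≗g ∘ suc))

Σ₂-zero : ∀ {n} {f : Fin n → Bool} → (∀ j → f j ≡ false) → Σ₂ f ≡ false
Σ₂-zero {zero}  f≗0 = refl
Σ₂-zero {suc n} f≗0 rewrite f≗0 zero = Σ₂-zero (f≗0 ∘ suc)

Σ₂-xor : ∀ {n} (f g : Fin n → Bool) → Σ₂ (λ j → f j xor g j) ≡ Σ₂ f xor Σ₂ g
Σ₂-xor {zero}  f g = refl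
Σ₂-xor {suc n} f g rewrite Σ₂-xor (f ∘ suc) (g ∘ suc) =
  solve 4 (λ a b c d → (a :+ b) :+ (c :+ d) := (a :+ c) :+ (b :+ d)) refl
    (f zero) (g zero) (Σ₂ (f ∘ suc)) (Σ₂ (g ∘ suc))

Σ₂-∧ˡ : ∀ {n} (b : Bool) (f : Fin n → Bool) → Σ₂ (λ j → b ∧ f j) ≡ b ∧ Σ₂ f
Σ₂-∧ˡ {zero}  b f = sym (∧-zeroʳ b)
Σ₂-∧ˡ {suc n} b f rewrite Σ₂-∧ˡ b (f ∘ suc) = sym (∧-distribˡ-xor b (f zero) (Σ₂ (f ∘ suc)))

Σ₂-swap : ∀ {m n} (f : Fin m → Fin n → Bool) →
  Σ₂ (λ i → Σ₂ (f i)) ≡ Σ₂ (λ j → Σ₂ (λ i → f i j))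
Σ₂-swap {zero}  {n} f = sym (Σ₂-zero {n} (λ _ → refl))
Σ₂-swap {suc m} f =
  trans (cong (Σ₂ (f zero) xor_) (Σ₂-swap (f ∘ suc)))
        (sym (Σ₂-xor (f zero) (λ j → Σ₂ (λ i → f (suc i) j))))

Σ₂-δ : ∀ {n} (k : Fin n) (f : Fin n → Bool) → Σ₂ (λ j → (j ≡ᵇ k) ∧ f j) ≡ f k
Σ₂-δ {suc n} zero    f = trans (cong (f zero xor_) (Σ₂-zero {n} (λ _ → refl))) (xor-identityʳ (f zero))
Σ₂-δ {suc n} (suc k) f = Σ₂-δ k (f ∘ suc)

Σ₂-true⇒∃ : ∀ {n} (f : Fin n → Bool) → Σ₂ f ≡ true → ∃[ j ] f j ≡ true
Σ₂-true⇒∃ f Σf≡1 with true-or-all-false f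
... | inj₁ ∃j  = ∃j
... | inj₂ f≗0 = ⊥-elim (true≢false (trans (sym Σf≡1) (Σ₂-zero f≗0)))

remove : ∀ {n} → (Fin n → Bool) → Fin n → Fin n → Bool
remove f k j = not (j ≡ᵇ k) ∧ f j

remove-true : ∀ {n} (f : Fin n → Bool) {k j : Fin n} → j ≢ k → f j ≡ true → remove f k j ≡ true
remove-true f j≢k fj rewrite ≢⇒≡ᵇ-false j≢k | fj = refl

remove-true⁻ : ∀ {n} (f : Fin n → Bool) (k j : Fin n) → remove f k j ≡ true → j ≢ k × f j ≡ true
remove-true⁻ f k j e with j ≡ᵇ k in j≡ᵇk | f j
... | false | true = ≡ᵇ-false⇒≢ j≡ᵇk , refl

Σ₂-remove : ∀ {n} (k : Fin n) (f : Fin n → Bool) → Σ₂ f ≡ f k xor Σ₂ (remove f k)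
Σ₂-remove {suc n} zero    f = refl
Σ₂-remove {suc n} (suc k) f rewrite Σ₂-remove k (f ∘ suc) =
  solve 3 (λ a b c → a :+ (b :+ c) := b :+ (a :+ c)) refl (f zero) (f (suc k)) (Σ₂ (remove (f ∘ suc) k))

Σ₂-single : ∀ {n} (f : Fin n → Bool) (k : Fin n) → f k ≡ true →
  (∀ j → f j ≡ true → j ≡ k) → Σ₂ f ≡ true
Σ₂-single f k fk unique rewrite Σ₂-remove k f | fk = cong not (Σ₂-zero rest≗0)
  where
  rest≗0 : ∀ j → remove f k j ≡ false
  rest≗0 j = ≢true⇒≡false λ e → let (j≢k , fj) = remove-true⁻ f k j e in j≢k (unique j fj)

count : ∀ {n} → (Fin n → Bool) → ℕ
count {zero}  f = 0
count {suc n} f = if f zero then suc (count (f ∘ suc)) else count (f ∘ suc)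

∣tabulate∣≡count : ∀ {n} (f : Fin n → Bool) → ∣ tabulate f ∣ ≡ count f
∣tabulate∣≡count {zero}  f = refl
∣tabulate∣≡count {suc n} f with f zero
... | true  = cong suc (∣tabulate∣≡count (f ∘ suc))
... | false = ∣tabulate∣≡count (f ∘ suc)

count-zero : ∀ {n} {f : Fin n → Bool} → (∀ j → f j ≡ false) → count f ≡ 0
count-zero {zero}  f≗0 = refl
count-zero {suc n} f≗0 rewrite f≗0 zero = count-zero (f≗0 ∘ suc)

count-remove : ∀ {n} (f : Fin n → Bool) (k : Fin n) → f k ≡ true → count f ≡ suc (count (remove f k))
count-remove {suc n} f zero    fk rewrite fk = refl
count-remove {suc n} f (suc k) fk with f zero
... | true  = cong suc (count-remove (f ∘ suc) k fk)
... | false = count-remove (f ∘ suc) k fk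

parity : ℕ → Bool
parity zero    = false
parity (suc n) = not (parity n)

parity-count : ∀ {n} (f : Fin n → Bool) → parity (count f) ≡ Σ₂ f
parity-count {zero}  f = refl
parity-count {suc n} f with f zero
... | true  = cong not (parity-count (f ∘ suc))
... | false = parity-count (f ∘ suc)

%2≡1⇒parity : ∀ n → n % 2 ≡ 1 → parity n ≡ true
%2≡1⇒parity (suc zero)    e = refl
%2≡1⇒parity (suc (suc n)) e = trans (not-involutive (parity n)) (%2≡1⇒parity n e)

parity⇒%2≡1 : ∀ n → parity n ≡ true → n % 2 ≡ 1
parity⇒%2≡1 (suc zero)    e = refl
parity⇒%2≡1 (suc (suc n)) e = parity⇒%2≡1 n (trans (sym (not-involutive (parity n))) e)

odd-weight⇔Σ₂ : ∀ {n} (f : Fin n → Bool) → ∣ tabulate f ∣ % 2 ≡ 1 ⇔ Σ₂ f ≡ true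
odd-weight⇔Σ₂ f = mk⇔
  (λ odd → trans (sym (parity-count f))
                 (trans (cong parity (sym (∣tabulate∣≡count f))) (%2≡1⇒parity ∣ tabulate f ∣ odd)))
  (λ Σ≡1 → parity⇒%2≡1 ∣ tabulate f ∣
             (trans (cong parity (∣tabulate∣≡count f)) (trans (parity-count f) Σ≡1)))

AtMostOne : ∀ {n} → (Fin n → Bool) → Set
AtMostOne f = ∀ i j → f i ≡ true → f j ≡ true → i ≡ j

AtMostTwo : ∀ {n} → (Fin n → Bool) → Set
AtMostTwo f = ∀ i j k → f i ≡ true → f j ≡ true → f k ≡ true → i ≡ j ⊎ i ≡ k ⊎ j ≡ k

AtMostOne-remove : ∀ {n} {f : Fin n → Bool} → AtMostOne f → ∀ {k} → f k ≡ true →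
  ∀ j → remove f k j ≡ false
AtMostOne-remove {f = f} ≤1 {k} fk j =
  ≢true⇒≡false λ e → let (j≢k , fj) = remove-true⁻ f k j e in j≢k (≤1 j k fj fk)

AtMostTwo-remove² : ∀ {n} {f : Fin n → Bool} → AtMostTwo f → ∀ {k k′} → f k ≡ true →
  remove f k k′ ≡ true → ∀ j → remove (remove f k) k′ j ≡ false
AtMostTwo-remove² {f = f} ≤2 {k} {k′} fk fk′ j = ≢true⇒≡false λ e →
  let (j≢k′ , e′) = remove-true⁻ (remove f k) k′ j e
      (j≢k  , fj) = remove-true⁻ f k j e′
      (k′≢k , fk′) = remove-true⁻ f k k′ fk′
  in [ k′≢k ∘ sym , [ j≢k ∘ sym , j≢k′ ∘ sym ]′ ]′ (≤2 k k′ j fk fk′ fj)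

count≥2 : ∀ {n} (f : Fin n → Bool) {i j} → i ≢ j → f i ≡ true → f j ≡ true → 2 ≤ count f
count≥2 f {i} {j} i≢j fi fj
  rewrite count-remove f i fi | count-remove (remove f i) j (remove-true f (i≢j ∘ sym) fj) =
  s≤s (s≤s z≤n)

count≥3 : ∀ {n} (f : Fin n → Bool) {i j k} → i ≢ j → i ≢ k → j ≢ k →
  f i ≡ true → f j ≡ true → f k ≡ true → 3 ≤ count f
count≥3 f {i} {j} {k} i≢j i≢k j≢k fi fj fk
  rewrite count-remove f i fi
        | count-remove (remove f i) j (remove-true f (i≢j ∘ sym) fj)
        | count-remove (remove (remove f i) j) k
            (remove-true (remove f i) (j≢k ∘ sym) (remove-true f (i≢k ∘ sym) fk)) =
  s≤s (s≤s (s≤s z≤n))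

count≤1⇒AtMostOne : ∀ {n} (f : Fin n → Bool) → count f ≤ 1 → AtMostOne f
count≤1⇒AtMostOne f ≤1 i j fi fj with i ≟ j
... | yes i≡j = i≡j
... | no  i≢j = contradiction (count≥2 f i≢j fi fj) (≤⇒≯ ≤1)

count≤2⇒AtMostTwo : ∀ {n} (f : Fin n → Bool) → count f ≤ 2 → AtMostTwo f
count≤2⇒AtMostTwo f ≤2 i j k fi fj fk with i ≟ j | i ≟ k | j ≟ k
... | yes i≡j | _       | _       = inj₁ i≡j
... | no _    | yes i≡k | _       = inj₂ (inj₁ i≡k)
... | no _    | no _    | yes j≡k = inj₂ (inj₂ j≡k)
... | no i≢j  | no i≢k  | no j≢k  = contradiction (count≥3 f i≢j i≢k j≢k fi fj fk) (≤⇒≯ ≤2)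

AtMostOne⇒count≤1 : ∀ {n} (f : Fin n → Bool) → AtMostOne f → count f ≤ 1
AtMostOne⇒count≤1 f ≤1 with true-or-all-false f
... | inj₂ f≗0 rewrite count-zero f≗0 = z≤n
... | inj₁ (k , fk) rewrite count-remove f k fk | count-zero (AtMostOne-remove ≤1 fk) = s≤s z≤n

AtMostTwo⇒count≤2 : ∀ {n} (f : Fin n → Bool) → AtMostTwo f → count f ≤ 2
AtMostTwo⇒count≤2 f ≤2 with true-or-all-false f
... | inj₂ f≗0 rewrite count-zero f≗0 = z≤n
... | inj₁ (k , fk) with true-or-all-false (remove f k)
...   | inj₂ f′≗0 rewrite count-remove f k fk | count-zero f′≗0 = s≤s z≤n
...   | inj₁ (k′ , fk′)
  rewrite count-remove f k fk | count-remove (remove f k) k′ fk′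
        | count-zero (AtMostTwo-remove² ≤2 fk fk′) = s≤s (s≤s z≤n)

-- Linear independence of columns, contraction and reindexing

dot : ∀ {n} → (Fin n → Bool) → (Fin n → Bool) → Bool
dot Y f = Σ₂ (λ j → Y j ∧ f j)

colSumᶠ : ∀ {r n} → Matrix r n → (Fin n → Bool) → Fin r → Bool
colSumᶠ A Y i = dot Y (A i)

Ker : ∀ {r n} → Matrix r n → (Fin n → Bool) → Set
Ker A Y = ∀ i → colSumᶠ A Y i ≡ false

_⊆ᶠ_ : ∀ {n} → (Fin n → Bool) → (Fin n → Bool) → Set
Y ⊆ᶠ X = ∀ j → Y j ≡ true → X j ≡ true

LinIndepᶠ : ∀ {r n} → Matrix r n → (Fin n → Bool) → Set
LinIndepᶠ A X = ∀ Y → Y ⊆ᶠ X → Ker A Y → ∀ j → Y j ≡ false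

dot-congˡ : ∀ {n} {Y Y′ : Fin n → Bool} (f : Fin n → Bool) → (∀ j → Y j ≡ Y′ j) → dot Y f ≡ dot Y′ f
dot-congˡ f Y≗Y′ = Σ₂-cong (λ j → cong (_∧ f j) (Y≗Y′ j))

dot-congʳ : ∀ {n} (Y : Fin n → Bool) {f g : Fin n → Bool} → (∀ j → f j ≡ g j) → dot Y f ≡ dot Y g
dot-congʳ Y f≗g = Σ₂-cong (λ j → cong (Y j ∧_) (f≗g j))

dot-xor : ∀ {n} (Y f g : Fin n → Bool) → dot Y (λ j → f j xor g j) ≡ dot Y f xor dot Y g
dot-xor Y f g = trans (Σ₂-cong (λ j → ∧-distribˡ-xor (Y j) (f j) (g j)))
                      (Σ₂-xor (λ j → Y j ∧ f j) (λ j → Y j ∧ g j))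

dot-scale : ∀ {n} (Y f : Fin n → Bool) (b : Bool) → dot Y (λ j → b ∧ f j) ≡ b ∧ dot Y f
dot-scale Y f b = trans (Σ₂-cong (λ j → ∧-swap (Y j) b (f j))) (Σ₂-∧ˡ b (λ j → Y j ∧ f j))
  where
  ∧-swap : ∀ x y z → x ∧ (y ∧ z) ≡ y ∧ (x ∧ z)
  ∧-swap = solve 3 (λ x y z → x :* (y :* z) := y :* (x :* z)) refl

dot-Σ₂ : ∀ {r n} (Y : Fin n → Bool) (T : Fin r → Bool) (A : Matrix r n) →
  dot Y (λ j → Σ₂ (λ i → T i ∧ A i j)) ≡ Σ₂ (λ i → T i ∧ colSumᶠ A Y i)
dot-Σ₂ Y T A = begin
  Σ₂ (λ j → Y j ∧ Σ₂ (λ i → T i ∧ A i j))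
    ≡⟨ Σ₂-cong (λ j → sym (Σ₂-∧ˡ (Y j) (λ i → T i ∧ A i j))) ⟩
  Σ₂ (λ j → Σ₂ (λ i → Y j ∧ (T i ∧ A i j)))
    ≡⟨ Σ₂-swap (λ j i → Y j ∧ (T i ∧ A i j)) ⟩
  Σ₂ (λ i → Σ₂ (λ j → Y j ∧ (T i ∧ A i j)))
    ≡⟨ Σ₂-cong (λ i → dot-scale Y (A i) (T i)) ⟩
  Σ₂ (λ i → T i ∧ colSumᶠ A Y i) ∎
  where open ≡-Reasoning

toggle : ∀ {n} → (Fin n → Bool) → Bool → Fin n → Fin n → Bool
toggle Y b c j = Y j xor (b ∧ (j ≡ᵇ c))

dot-toggle : ∀ {n} (Y f : Fin n → Bool) (b : Bool) (c : Fin n) →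
  dot (toggle Y b c) f ≡ dot Y f xor (b ∧ f c)
dot-toggle Y f b c = begin
  dot (toggle Y b c) f
    ≡⟨ Σ₂-cong (λ j → ∧-distribʳ-xor (f j) (Y j) _) ⟩
  Σ₂ (λ j → (Y j ∧ f j) xor ((b ∧ (j ≡ᵇ c)) ∧ f j))
    ≡⟨ Σ₂-xor (λ j → Y j ∧ f j) _ ⟩
  dot Y f xor Σ₂ (λ j → (b ∧ (j ≡ᵇ c)) ∧ f j)
    ≡⟨ cong (dot Y f xor_) (Σ₂-cong (λ j → ∧-assoc b (j ≡ᵇ c) (f j))) ⟩
  dot Y f xor Σ₂ (λ j → b ∧ ((j ≡ᵇ c) ∧ f j))
    ≡⟨ cong (dot Y f xor_) (Σ₂-∧ˡ b (λ j → (j ≡ᵇ c) ∧ f j)) ⟩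
  dot Y f xor (b ∧ Σ₂ (λ j → (j ≡ᵇ c) ∧ f j))
    ≡⟨ cong (λ s → dot Y f xor (b ∧ s)) (Σ₂-δ c f) ⟩
  dot Y f xor (b ∧ f c) ∎
  where open ≡-Reasoning

toggle-true⁻ : ∀ {n} (Y : Fin n → Bool) b c j → toggle Y b c j ≡ true → Y j ≡ true ⊎ j ≡ c
toggle-true⁻ Y b c j e with Y j | j ≟ c
... | true  | _        = inj₁ refl
... | false | yes j≡c  = inj₂ j≡c
... | false | no _     rewrite ∧-zeroʳ b = ⊥-elim (true≢false (sym e))

∈⇒lookup : ∀ {n} {x : Fin n} {X : Subset n} → x ∈ X → lookup X x ≡ true
∈⇒lookup = []=⇒lookup

lookup⇒∈ : ∀ {n} {x : Fin n} {X : Subset n} → lookup X x ≡ true → x ∈ X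
lookup⇒∈ {x = x} {X} = lookup⇒[]= x X

lookup-≗⇒≡ : ∀ {n} {A : Set} (xs ys : Vec A n) → (∀ j → lookup xs j ≡ lookup ys j) → xs ≡ ys
lookup-≗⇒≡ xs ys xs≗ys =
  trans (sym (tabulate∘lookup xs)) (trans (tabulate-cong xs≗ys) (tabulate∘lookup ys))

LinIndep⇔LinIndepᶠ : ∀ {r n} (A : Matrix r n) (X : Subset n) → LinIndep A X ⇔ LinIndepᶠ A (lookup X)
LinIndep⇔LinIndepᶠ A X = mk⇔ to from
  where
  to : LinIndep A X → LinIndepᶠ A (lookup X)
  to li Y Y⊆X Y∈Ker j = begin
    Y j                    ≡⟨ sym (lookup∘tabulate Y j) ⟩
    lookup (tabulate Y) j  ≡⟨ cong (λ Z → lookup Z j) tabulateY≡∅ ⟩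
    lookup ∅ j             ≡⟨ lookup-replicate j false ⟩
    false                  ∎
    where
    open ≡-Reasoning
    tabulateY≡∅ : tabulate Y ≡ ∅
    tabulateY≡∅ = li (tabulate Y)
      (λ {x} x∈ → lookup⇒∈ (Y⊆X x (trans (sym (lookup∘tabulate Y x)) (∈⇒lookup x∈))))
      (λ i → trans (dot-congˡ (A i) (lookup∘tabulate Y)) (Y∈Ker i))
  from : LinIndepᶠ A (lookup X) → LinIndep A X
  from li Y Y⊆X Y∈Ker = lookup-≗⇒≡ Y ∅ λ j →
    trans (li (lookup Y) (λ x e → ∈⇒lookup (Y⊆X (lookup⇒∈ e))) Y∈Ker j) (sym (lookup-replicate j false))

LinIndepᶠ-cong : ∀ {r n} (A : Matrix r n) {X X′ : Fin n → Bool} → (∀ j → X j ≡ X′ j) →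
  LinIndepᶠ A X ⇔ LinIndepᶠ A X′
LinIndepᶠ-cong A X≗X′ = mk⇔ (λ li Y Y⊆ → li Y (λ j e → trans (X≗X′ j) (Y⊆ j e)))
                            (λ li Y Y⊆ → li Y (λ j e → trans (sym (X≗X′ j)) (Y⊆ j e)))

Ker⊆⇒LinIndepᶠ : ∀ {r s n} (A : Matrix r n) (B : Matrix s n) → (∀ Y → Ker A Y → Ker B Y) →
  ∀ X → LinIndepᶠ B X → LinIndepᶠ A X
Ker⊆⇒LinIndepᶠ A B ker⊆ X li Y Y⊆X Y∈Ker = li Y Y⊆X (ker⊆ Y Y∈Ker)

sameKer⇒iso : ∀ {r s n} {M : Matroid n} (A : Matrix r n) (B : Matrix s n) →
  (∀ Y → Ker A Y → Ker B Y) → (∀ Y → Ker B Y → Ker A Y) →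
  IsoToColumnMatroid M A → IsoToColumnMatroid M B
sameKer⇒iso A B A⊆B B⊆A (π , iso) = π , λ X →
  ⇔.trans (iso X) (⇔.trans (LinIndep⇔LinIndepᶠ A (image π X))
    (⇔.trans (mk⇔ (Ker⊆⇒LinIndepᶠ B A B⊆A _) (Ker⊆⇒LinIndepᶠ A B A⊆B _))
             (⇔.sym (LinIndep⇔LinIndepᶠ B (image π X)))))

remove-≢ : ∀ {n} (Y : Fin n → Bool) {c j} → j ≢ c → remove Y c j ≡ Y j
remove-≢ Y j≢c rewrite ≢⇒≡ᵇ-false j≢c = refl

toggle-≢ : ∀ {n} (Y : Fin n → Bool) b {c j} → j ≢ c → toggle Y b c j ≡ Y j
toggle-≢ Y b {c} {j} j≢c rewrite ≢⇒≡ᵇ-false j≢c | ∧-zeroʳ b = xor-identityʳ (Y j)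

dot-remove : ∀ {n} (Y f : Fin n → Bool) (c : Fin n) → dot Y f ≡ (Y c ∧ f c) xor dot (remove Y c) f
dot-remove Y f c = trans (Σ₂-remove c (λ j → Y j ∧ f j))
  (cong ((Y c ∧ f c) xor_) (Σ₂-cong (λ j → sym (∧-assoc (not (j ≡ᵇ c)) (Y j) (f j)))))

contract : ∀ {r n} → Matrix r n → Fin n → Fin r → Matrix r n
contract A c p i j = if i ≡ᵇ p then false else (A i j xor (A i c ∧ A p j))

module Contraction {r n} (A : Matrix r n) (c : Fin n) (p : Fin r) (Apc : A p c ≡ true) where

  A′ : Matrix r n
  A′ = contract A c p

  -- Adding column c with the coefficient that clears the pivot row turns a dependency of A′ into one of A
  lift : (Fin n → Bool) → Fin n → Bool
  lift Y = toggle Y (colSumᶠ A Y p) c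

  colSumᶠ-lift : ∀ Y i → colSumᶠ A (lift Y) i ≡ colSumᶠ A′ Y i
  colSumᶠ-lift Y i rewrite dot-toggle Y (A i) (colSumᶠ A Y p) c with i ≟ p
  ... | yes refl rewrite Apc | ∧-identityʳ (colSumᶠ A Y p) =
    trans (xor-same (colSumᶠ A Y p)) (sym (Σ₂-zero (λ j → ∧-zeroʳ (Y j))))
  ... | no _ = sym (begin
    dot Y (λ j → A i j xor (A i c ∧ A p j))
      ≡⟨ dot-xor Y (A i) (λ j → A i c ∧ A p j) ⟩
    colSumᶠ A Y i xor dot Y (λ j → A i c ∧ A p j)
      ≡⟨ cong (colSumᶠ A Y i xor_) (dot-scale Y (A p) (A i c)) ⟩
    colSumᶠ A Y i xor (A i c ∧ colSumᶠ A Y p)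
      ≡⟨ cong (colSumᶠ A Y i xor_) (∧-comm (A i c) _) ⟩
    colSumᶠ A Y i xor (colSumᶠ A Y p ∧ A i c) ∎)
    where open ≡-Reasoning

  colSumᶠ-remove-pivot : ∀ Y → Ker A Y → colSumᶠ A (remove Y c) p ≡ Y c
  colSumᶠ-remove-pivot Y Y∈Ker = begin
    S
      ≡⟨ solve 2 (λ x y → y := x :+ (x :+ y)) refl (Y c) S ⟩
    Y c xor (Y c xor S)
      ≡⟨ cong (λ a → Y c xor (a xor S)) (trans (cong (Y c ∧_) Apc) (∧-identityʳ (Y c))) ⟨
    Y c xor ((Y c ∧ A p c) xor S)
      ≡⟨ cong (Y c xor_) (dot-remove Y (A p) c) ⟨
    Y c xor colSumᶠ A Y p
      ≡⟨ cong (Y c xor_) (Y∈Ker p) ⟩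
    Y c xor false
      ≡⟨ xor-identityʳ (Y c) ⟩
    Y c ∎
    where
    open ≡-Reasoning
    S = colSumᶠ A (remove Y c) p

  lift-remove : ∀ Y → Ker A Y → ∀ j → lift (remove Y c) j ≡ Y j
  lift-remove Y Y∈Ker j rewrite colSumᶠ-remove-pivot Y Y∈Ker with j ≟ c
  ... | yes refl rewrite ∧-identityʳ (Y j) = refl
  ... | no _     rewrite ∧-zeroʳ (Y c) = xor-identityʳ (Y j)

  LinIndepᶠ-contract : ∀ X → X c ≡ true → LinIndepᶠ A X ⇔ LinIndepᶠ A′ (remove X c)
  LinIndepᶠ-contract X Xc = mk⇔ to from
    where
    to : LinIndepᶠ A X → LinIndepᶠ A′ (remove X c)
    to li Y Y⊆X-c Y∈Ker′ j with j ≟ c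
    ... | yes refl = ≢true⇒≡false λ Yc → proj₁ (remove-true⁻ X c c (Y⊆X-c c Yc)) refl
    ... | no j≢c   = trans (sym (toggle-≢ Y _ j≢c)) (liftY≗0 j)
      where
      lift⊆X : lift Y ⊆ᶠ X
      lift⊆X j e = [ (λ Yj → proj₂ (remove-true⁻ X c j (Y⊆X-c j Yj))) , (λ { refl → Xc }) ]′
                   (toggle-true⁻ Y (colSumᶠ A Y p) c j e)
      liftY≗0 : ∀ j → lift Y j ≡ false
      liftY≗0 = li (lift Y) lift⊆X (λ i → trans (colSumᶠ-lift Y i) (Y∈Ker′ i))
    from : LinIndepᶠ A′ (remove X c) → LinIndepᶠ A X
    from li Y Y⊆X Y∈Ker = Y≗0
      where
      Y-c≗0 : ∀ j → remove Y c j ≡ false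
      Y-c≗0 = li (remove Y c)
        (λ j e → let (j≢c , Yj) = remove-true⁻ Y c j e in remove-true X j≢c (Y⊆X j Yj))
        (λ i → trans (sym (colSumᶠ-lift (remove Y c) i))
                     (trans (dot-congˡ (A i) (lift-remove Y Y∈Ker)) (Y∈Ker i)))
      Y≗0 : ∀ j → Y j ≡ false
      Y≗0 j with j ≟ c
      ... | yes refl = trans (sym (colSumᶠ-remove-pivot Y Y∈Ker))
                             (trans (dot-congˡ (A p) Y-c≗0) (Σ₂-zero {n} (λ _ → refl)))
      ... | no j≢c   = trans (sym (remove-≢ Y j≢c)) (Y-c≗0 j)

push : ∀ {m n} → (Fin m → Fin n) → (Fin m → Bool) → Fin n → Bool
push ψ Y j = Σ₂ (λ x → Y x ∧ (ψ x ≡ᵇ j))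

dot-push : ∀ {m n} (ψ : Fin m → Fin n) (Y : Fin m → Bool) (f : Fin n → Bool) →
  dot (push ψ Y) f ≡ dot Y (f ∘ ψ)
dot-push ψ Y f = begin
  Σ₂ (λ j → push ψ Y j ∧ f j)
    ≡⟨ Σ₂-cong (λ j → trans (∧-comm (push ψ Y j) (f j))
      (sym (Σ₂-∧ˡ (f j) (λ x → Y x ∧ (ψ x ≡ᵇ j))))) ⟩
  Σ₂ (λ j → Σ₂ (λ x → f j ∧ (Y x ∧ (ψ x ≡ᵇ j))))
    ≡⟨ Σ₂-swap (λ j x → f j ∧ (Y x ∧ (ψ x ≡ᵇ j))) ⟩
  Σ₂ (λ x → Σ₂ (λ j → f j ∧ (Y x ∧ (ψ x ≡ᵇ j))))
    ≡⟨ Σ₂-cong (λ x → Σ₂-cong (λ j → rearrange (f j) (Y x) (ψ x) j)) ⟩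
  Σ₂ (λ x → Σ₂ (λ j → Y x ∧ ((j ≡ᵇ ψ x) ∧ f j)))
    ≡⟨ Σ₂-cong (λ x → Σ₂-∧ˡ (Y x) (λ j → (j ≡ᵇ ψ x) ∧ f j)) ⟩
  Σ₂ (λ x → Y x ∧ Σ₂ (λ j → (j ≡ᵇ ψ x) ∧ f j))
    ≡⟨ Σ₂-cong (λ x → cong (Y x ∧_) (Σ₂-δ (ψ x) f)) ⟩
  Σ₂ (λ x → Y x ∧ f (ψ x)) ∎
  where
  open ≡-Reasoning
  rearrange : ∀ a b k j → a ∧ (b ∧ (k ≡ᵇ j)) ≡ b ∧ ((j ≡ᵇ k) ∧ a)
  rearrange a b k j rewrite ≡ᵇ-sym k j = solve 3 (λ a b d → a :* (b :* d) := b :* (d :* a)) refl a b (j ≡ᵇ k)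

push-true⁻ : ∀ {m n} (ψ : Fin m → Fin n) (Y : Fin m → Bool) j → push ψ Y j ≡ true →
  ∃[ x ] (Y x ≡ true × ψ x ≡ j)
push-true⁻ ψ Y j e with Σ₂-true⇒∃ _ e
... | x , Yx∧ψx≡j with Y x in Yx | ψ x ≟ j
...   | true | yes ψx≡j = x , Yx , ψx≡j

push-true : ∀ {m n} (ψ : Fin m → Fin n) → Injective _≡_ _≡_ ψ → (Y : Fin m → Bool) {x : Fin m} →
  Y x ≡ true → push ψ Y (ψ x) ≡ true
push-true ψ ψ-inj Y {x} Yx =
  Σ₂-single _ x (trans (cong (_∧ (ψ x ≡ᵇ ψ x)) Yx) (≡ᵇ-refl (ψ x))) only-x
  where
  only-x : ∀ y → Y y ∧ (ψ y ≡ᵇ ψ x) ≡ true → y ≡ x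
  only-x y e with Y y | ψ y ≟ ψ x
  ... | true | yes ψy≡ψx = ψ-inj ψy≡ψx

module Reindexing {r m n} (A : Matrix r n) (ψ : Fin m → Fin n) (ψ-inj : Injective _≡_ _≡_ ψ)
                  (X : Fin m → Bool) (Z : Fin n → Bool)
                  (Z⊆ψX : ∀ j → Z j ≡ true → ∃[ x ] (X x ≡ true × ψ x ≡ j))
                  (ψX⊆Z : ∀ x → X x ≡ true → Z (ψ x) ≡ true) where

  Aψ : Matrix r m
  Aψ i x = A i (ψ x)

  push-restrict : ∀ Y′ → Y′ ⊆ᶠ Z → ∀ j → push ψ (Y′ ∘ ψ) j ≡ Y′ j
  push-restrict Y′ Y′⊆Z j with Y′ j in Y′j
  ... | true  = let (x , _ , ψx≡j) = Z⊆ψX j (Y′⊆Z j Y′j) in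
                subst (λ k → push ψ (Y′ ∘ ψ) k ≡ true) ψx≡j
                      (push-true ψ ψ-inj (Y′ ∘ ψ) (trans (cong Y′ ψx≡j) Y′j))
  ... | false = ≢true⇒≡false λ e → let (x , Y′ψx , ψx≡j) = push-true⁻ ψ (Y′ ∘ ψ) j e in
                true≢false (trans (sym Y′ψx) (trans (cong Y′ ψx≡j) Y′j))

  LinIndepᶠ-reindex : LinIndepᶠ A Z ⇔ LinIndepᶠ Aψ X
  LinIndepᶠ-reindex = mk⇔ to from
    where
    to : LinIndepᶠ A Z → LinIndepᶠ Aψ X
    to li Y Y⊆X Y∈Ker x = ≢true⇒≡false λ Yx →
      true≢false (trans (sym (push-true ψ ψ-inj Y Yx)) (pushY≗0 (ψ x)))
      where
      pushY≗0 : ∀ j → push ψ Y j ≡ false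
      pushY≗0 = li (push ψ Y)
        (λ j e → let (x , Yx , ψx≡j) = push-true⁻ ψ Y j e in subst (λ k → Z k ≡ true) ψx≡j (ψX⊆Z x (Y⊆X x Yx)))
        (λ i → trans (dot-push ψ Y (A i)) (Y∈Ker i))
    from : LinIndepᶠ Aψ X → LinIndepᶠ A Z
    from li Y′ Y′⊆Z Y′∈Ker j = ≢true⇒≡false λ Y′j →
      let (x , _ , ψx≡j) = Z⊆ψX j (Y′⊆Z j Y′j) in
      true≢false (trans (sym (trans (cong Y′ ψx≡j) Y′j)) (Y′ψ≗0 x))
      where
      Y′ψ⊆X : (Y′ ∘ ψ) ⊆ᶠ X
      Y′ψ⊆X x e = let (x′ , Xx′ , ψx′≡ψx) = Z⊆ψX (ψ x) (Y′⊆Z (ψ x) e) in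
                  subst (λ y → X y ≡ true) (ψ-inj ψx′≡ψx) Xx′
      Y′ψ≗0 : ∀ x → Y′ (ψ x) ≡ false
      Y′ψ≗0 = li (Y′ ∘ ψ) Y′ψ⊆X λ i →
        trans (sym (dot-push ψ (Y′ ∘ ψ) (A i)))
              (trans (dot-congˡ (A i) (push-restrict Y′ Y′⊆Z)) (Y′∈Ker i))

-- Template columns

TemplateColumn : ∀ {r} → Bool → Bool → (Fin r → Bool) → Set
TemplateColumn x₁ x₂ g =
  (x₁ ≡ false × x₂ ≡ false × AtMostTwo g) ⊎ ((x₁ ≡ true ⊎ x₂ ≡ true) × AtMostOne g)

rowsR : ∀ {r n} → Matrix (2 + r) n → Fin n → Fin r → Bool
rowsR A j i = A (suc (suc i)) j

Conforms : ∀ {r n} → Matrix (2 + r) n → Fin n → Set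
Conforms A j = TemplateColumn (A zero j) (A (suc zero) j) (rowsR A j)

AtMostOne-empty : ∀ {r} {g : Fin r → Bool} → (∀ i → g i ≡ false) → AtMostOne g
AtMostOne-empty g≗0 i j gi _ = ⊥-elim (true≢false (trans (sym gi) (g≗0 i)))

⊆-single⇒AtMostOne : ∀ {r} {g : Fin r → Bool} c → (∀ i → g i ≡ true → i ≡ c) → AtMostOne g
⊆-single⇒AtMostOne c ⊆c i j gi gj = trans (⊆c i gi) (sym (⊆c j gj))

≡ᵇ-AtMostOne : ∀ {r} (c : Fin r) → AtMostOne (_≡ᵇ c)
≡ᵇ-AtMostOne c = ⊆-single⇒AtMostOne c (λ i → ≡ᵇ⇒≡)

AtMostTwo-remove : ∀ {r} {g : Fin r → Bool} → AtMostTwo g → ∀ {k} → g k ≡ true → AtMostOne (remove g k)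
AtMostTwo-remove {g = g} ≤2 {k} gk i j gi gj =
  let (i≢k , gi′) = remove-true⁻ g k i gi
      (j≢k , gj′) = remove-true⁻ g k j gj
  in [ (λ k≡i → ⊥-elim (i≢k (sym k≡i))) , [ (λ k≡j → ⊥-elim (j≢k (sym k≡j))) , id ]′ ]′
       (≤2 k i j gk gi′ gj′)

AtMostTwo-∪ : ∀ {r} {f g u : Fin r → Bool} → AtMostOne f → AtMostOne g →
  (∀ i → u i ≡ true → f i ≡ true ⊎ g i ≡ true) → AtMostTwo u
AtMostTwo-∪ ≤1f ≤1g u⊆f∪g i j k ui uj uk
  with u⊆f∪g i ui | u⊆f∪g j uj | u⊆f∪g k uk
... | inj₁ fi | inj₁ fj | _      = inj₁ (≤1f i j fi fj)
... | inj₂ gi | inj₂ gj | _      = inj₁ (≤1g i j gi gj)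
... | inj₁ fi | _      | inj₁ fk = inj₂ (inj₁ (≤1f i k fi fk))
... | inj₂ gi | _      | inj₂ gk = inj₂ (inj₁ (≤1g i k gi gk))
... | _      | inj₁ fj | inj₁ fk = inj₂ (inj₂ (≤1f j k fj fk))
... | _      | inj₂ gj | inj₂ gk = inj₂ (inj₂ (≤1g j k gj gk))

template-AtMostOne : ∀ {r} (x₁ x₂ : Bool) {g : Fin r → Bool} → AtMostOne g → TemplateColumn x₁ x₂ g
template-AtMostOne false false ≤1 = inj₁ (refl , refl , λ i j k gi gj _ → inj₁ (≤1 i j gi gj))
template-AtMostOne true  x₂    ≤1 = inj₂ (inj₁ refl , ≤1)
template-AtMostOne false true  ≤1 = inj₂ (inj₂ refl , ≤1)

template-shrink : ∀ {r} {x₁ x₂ y₁ y₂} {g g′ : Fin r → Bool} → TemplateColumn x₁ x₂ g →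
  (∀ i → g′ i ≡ true → g i ≡ true) → (x₁ ≡ false → x₂ ≡ false → y₁ ≡ false × y₂ ≡ false) →
  TemplateColumn y₁ y₂ g′
template-shrink (inj₁ (x₁≡0 , x₂≡0 , ≤2)) g′⊆g ys≡0 =
  let (y₁≡0 , y₂≡0) = ys≡0 x₁≡0 x₂≡0 in
  inj₁ (y₁≡0 , y₂≡0 , λ i j k gi gj gk → ≤2 i j k (g′⊆g i gi) (g′⊆g j gj) (g′⊆g k gk))
template-shrink (inj₂ (_ , ≤1)) g′⊆g _ =
  template-AtMostOne _ _ (λ i j gi gj → ≤1 i j (g′⊆g i gi) (g′⊆g j gj))

conforms⇒ : ∀ {r n} (A : Matrix (2 + r) n) → ConformsΦY1 A → ∀ j → Conforms A j
conforms⇒ A conf j with conf j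
... | inj₁ (x₁≡0 , x₂≡0 , w≤2) =
  inj₁ (x₁≡0 , x₂≡0 , count≤2⇒AtMostTwo (rowsR A j) (subst (_≤ 2) (∣tabulate∣≡count (rowsR A j)) w≤2))
... | inj₂ (xs , w≤1) =
  inj₂ (some-x xs , count≤1⇒AtMostOne (rowsR A j) (subst (_≤ 1) (∣tabulate∣≡count (rowsR A j)) w≤1))
  where
  some-x : ∀ {x₁ x₂ : Bool} →
    (x₁ ≡ true × x₂ ≡ false) ⊎ (x₁ ≡ false × x₂ ≡ true) ⊎ (x₁ ≡ true × x₂ ≡ true) →
    x₁ ≡ true ⊎ x₂ ≡ true
  some-x (inj₁ (x₁≡1 , _))        = inj₁ x₁≡1
  some-x (inj₂ (inj₁ (_ , x₂≡1))) = inj₂ x₂≡1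
  some-x (inj₂ (inj₂ (x₁≡1 , _))) = inj₁ x₁≡1

⇒conforms : ∀ {r n} (A : Matrix (2 + r) n) → (∀ j → Conforms A j) → ConformsΦY1 A
⇒conforms A conf j with conf j
... | inj₁ (x₁≡0 , x₂≡0 , ≤2) =
  inj₁ (x₁≡0 , x₂≡0 , subst (_≤ 2) (sym (∣tabulate∣≡count (rowsR A j))) (AtMostTwo⇒count≤2 (rowsR A j) ≤2))
... | inj₂ (xs , ≤1) =
  inj₂ (nonzero-x (A zero j) (A (suc zero) j) xs ,
        subst (_≤ 1) (sym (∣tabulate∣≡count (rowsR A j))) (AtMostOne⇒count≤1 (rowsR A j) ≤1))
  where
  nonzero-x : ∀ x₁ x₂ → x₁ ≡ true ⊎ x₂ ≡ true →
    (x₁ ≡ true × x₂ ≡ false) ⊎ (x₁ ≡ false × x₂ ≡ true) ⊎ (x₁ ≡ true × x₂ ≡ true)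
  nonzero-x true  false _ = inj₁ (refl , refl)
  nonzero-x false true  _ = inj₂ (inj₁ (refl , refl))
  nonzero-x true  true  _ = inj₂ (inj₂ (refl , refl))
  nonzero-x false false (inj₁ ())
  nonzero-x false false (inj₂ ())

pivot-support : ∀ {r} (g h : Fin r → Bool) (k : Fin r) (t : Bool) i →
  (if i ≡ᵇ k then false else g i xor (h i ∧ t)) ≡ true →
  remove g k i ≡ true ⊎ (t ≡ true × remove h k i ≡ true)
pivot-support g h k t i e with i ≟ k
... | no _ with g i | h i | t
...   | true  | _    | _    = inj₁ refl
...   | false | true | true = inj₂ (refl , refl)

template-pivotR : ∀ {r} {x₁ x₂ a b : Bool} {g h : Fin r → Bool} {k : Fin r} → h k ≡ true →
  TemplateColumn a b h → TemplateColumn x₁ x₂ g →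
  TemplateColumn (x₁ xor (a ∧ g k)) (x₂ xor (b ∧ g k))
                 (λ i → if i ≡ᵇ k then false else g i xor (h i ∧ g k))
template-pivotR {x₁ = x₁} {x₂} {a} {b} {g} {h} {k} hk col-c col-j with g k in gk
... | false = template-shrink col-j
      (λ i e → [ proj₂ ∘ remove-true⁻ g k i , (λ ()) ∘ proj₁ ]′ (pivot-support g h k false i e))
      (λ { refl refl → cong (false xor_) (∧-zeroʳ a) , cong (false xor_) (∧-zeroʳ b) })
... | true = through col-c col-j
  where
  support : ∀ i → _ ≡ true → remove g k i ≡ true ⊎ remove h k i ≡ true
  support i e = [ inj₁ , inj₂ ∘ proj₂ ]′ (pivot-support g h k true i e)
  through : TemplateColumn a b h → TemplateColumn x₁ x₂ g →
    TemplateColumn (x₁ xor (a ∧ true)) (x₂ xor (b ∧ true))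
                   (λ i → if i ≡ᵇ k then false else g i xor (h i ∧ true))
  through (inj₁ (refl , refl , ≤2h)) (inj₁ (x₁≡0 , x₂≡0 , ≤2g)) =
    inj₁ (trans (xor-identityʳ x₁) x₁≡0 , trans (xor-identityʳ x₂) x₂≡0 ,
          AtMostTwo-∪ (AtMostTwo-remove ≤2g gk) (AtMostTwo-remove ≤2h hk) support)
  through (inj₁ (refl , refl , ≤2h)) (inj₂ (_ , ≤1g)) =
    template-AtMostOne _ _ λ i j gi gj → AtMostTwo-remove ≤2h hk i j (only-h i gi) (only-h j gj)
    where
    only-h : ∀ i → _ → remove h k i ≡ true
    only-h i e = [ (λ g′i → ⊥-elim (true≢false (trans (sym g′i) (AtMostOne-remove ≤1g gk i)))) , id ]′ (support i e)
  through (inj₂ (ab , ≤1h)) (inj₁ (refl , refl , ≤2g)) =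
    inj₂ ([ inj₁ ∘ trans (∧-identityʳ a) , inj₂ ∘ trans (∧-identityʳ b) ]′ ab ,
          λ i j gi gj → AtMostTwo-remove ≤2g gk i j (only-g i gi) (only-g j gj))
    where
    only-g : ∀ i → _ → remove g k i ≡ true
    only-g i e = [ id , (λ h′i → ⊥-elim (true≢false (trans (sym h′i) (AtMostOne-remove ≤1h hk i)))) ]′ (support i e)
  through (inj₂ (_ , ≤1h)) (inj₂ (_ , ≤1g)) = template-AtMostOne _ _ (AtMostOne-empty empty)
    where
    empty : ∀ i → (if i ≡ᵇ k then false else g i xor (h i ∧ true)) ≡ false
    empty i = ≢true⇒≡false λ e → [ (λ g′i → true≢false (trans (sym g′i) (AtMostOne-remove ≤1g gk i)))
                                  , (λ h′i → true≢false (trans (sym h′i) (AtMostOne-remove ≤1h hk i))) ]′ (support i e)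

xor-∧-false : ∀ {g h} t → h ≡ false → g xor (h ∧ t) ≡ g
xor-∧-false {g} t refl = xor-identityʳ g

conforms-contract : ∀ {r n} (A : Matrix (2 + r) n) (c : Fin n) → (∀ j → Conforms A j) →
  ∃[ i ] A i c ≡ true → ∃[ p ] (A p c ≡ true × ∀ j → Conforms (contract A c p) j)
conforms-contract A c conf (i , Aic) with true-or-all-false (rowsR A c)
... | inj₁ (k , Akc) = suc (suc k) , Akc , λ j → template-pivotR Akc (conf c) (conf j)
... | inj₂ Rc≗0 with A zero c in A₀c
...   | true  = zero , A₀c , λ j → template-shrink (conf j) (λ i → trans (sym (xor-∧-false _ (Rc≗0 i))))
        λ x₁≡0 x₂≡0 → refl , trans (cong₂ (λ x₂ x₁ → x₂ xor (A (suc zero) c ∧ x₁)) x₂≡0 x₁≡0)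
                                   (∧-zeroʳ (A (suc zero) c))
...   | false = suc zero , A₁c (conf c) i Aic , λ j → template-shrink (conf j) (λ i → trans (sym (xor-∧-false _ (Rc≗0 i))))
        λ x₁≡0 x₂≡0 → cong (_xor false) x₁≡0 , refl
  where
  A₁c : Conforms A c → ∀ i → A i c ≡ true → A (suc zero) c ≡ true
  A₁c (inj₂ (inj₂ x₂≡1 , _)) _ _ = x₂≡1
  A₁c (inj₂ (inj₁ x₁≡1 , _)) _ _ = ⊥-elim (true≢false (trans (sym x₁≡1) A₀c))
  A₁c (inj₁ (_ , x₂≡0 , _)) zero          Aic = ⊥-elim (true≢false (trans (sym Aic) A₀c))
  A₁c (inj₁ (_ , x₂≡0 , _)) (suc zero)    Aic = ⊥-elim (true≢false (trans (sym Aic) x₂≡0))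
  A₁c (inj₁ (_ , x₂≡0 , _)) (suc (suc k)) Aic = ⊥-elim (true≢false (trans (sym Aic) (Rc≗0 k)))

-- Minors

_∪ᶠ_ : ∀ {n} → (Fin n → Bool) → (Fin n → Bool) → Fin n → Bool
(Z ∪ᶠ B) j = Z j ∨ B j

Disjointᶠ : ∀ {n} → (Fin n → Bool) → (Fin n → Bool) → Set
Disjointᶠ Z B = ∀ j → Z j ≡ true → B j ≡ false

independent⇒nonzero-column : ∀ {r n} (A : Matrix r n) {B : Fin n → Bool} {c : Fin n} →
  LinIndepᶠ A B → B c ≡ true → ∃[ i ] A i c ≡ true
independent⇒nonzero-column A {B} {c} li Bc with true-or-all-false (λ i → A i c)
... | inj₁ nonzero  = nonzero
... | inj₂ column≗0 = ⊥-elim (true≢false (trans (sym (≡ᵇ-refl c)) (li (_≡ᵇ c) c-only c-in-Ker c)))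
  where
  c-only : (_≡ᵇ c) ⊆ᶠ B
  c-only j e = subst (λ k → B k ≡ true) (sym (≡ᵇ⇒≡ e)) Bc
  c-in-Ker : Ker A (_≡ᵇ c)
  c-in-Ker i = trans (Σ₂-δ c (A i)) (column≗0 i)

-- t is fuel: a bound on the size of B.
contract-independent : ∀ {r n} (t : ℕ) (A : Matrix (2 + r) n) (B : Fin n → Bool) → count B ≤ t →
  (∀ j → Conforms A j) → LinIndepᶠ A B →
  Σ (Matrix (2 + r) n) λ A′ → (∀ j → Conforms A′ j) ×
    (∀ Z → Disjointᶠ Z B → LinIndepᶠ A (Z ∪ᶠ B) ⇔ LinIndepᶠ A′ Z)
contract-independent t A B ∣B∣≤t conf li with true-or-all-false B
... | inj₂ B≗0 = A , conf , λ Z _ →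
  LinIndepᶠ-cong A (λ j → trans (cong (Z j ∨_) (B≗0 j)) (∨-identityʳ (Z j)))
contract-independent zero _ B ∣B∣≤0 _ _ | inj₁ (c , Bc) =
  contradiction (subst (_≤ 0) (count-remove B c Bc) ∣B∣≤0) λ ()
contract-independent (suc t) A B ∣B∣≤t conf li | inj₁ (c , Bc) =
  A″ , conf″ , λ Z Z∩B≡∅ →
    ⇔.trans (LinIndepᶠ-contract (Z ∪ᶠ B) (trans (cong (Z c ∨_) Bc) (∨-zeroʳ (Z c))))
   (⇔.trans (LinIndepᶠ-cong A′ (remove-∪ Z Z∩B≡∅))
            (B-c-contracted Z (λ j Zj → trans (cong (not (j ≡ᵇ c) ∧_) (Z∩B≡∅ j Zj)) (∧-zeroʳ _))))
  where
  pivot = conforms-contract A c conf (independent⇒nonzero-column A li Bc)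
  p = proj₁ pivot
  open Contraction A c p (proj₁ (proj₂ pivot))
  rec = contract-independent t A′ (remove B c)
          (≤-pred (subst (_≤ suc t) (count-remove B c Bc) ∣B∣≤t))
          (proj₂ (proj₂ pivot)) (Equivalence.to (LinIndepᶠ-contract B Bc) li)
  A″ = proj₁ rec
  conf″ = proj₁ (proj₂ rec)
  B-c-contracted = proj₂ (proj₂ rec)
  remove-∪ : ∀ Z → Disjointᶠ Z B → ∀ j → remove (Z ∪ᶠ B) c j ≡ (Z ∪ᶠ remove B c) j
  remove-∪ Z Z∩B≡∅ j with j ≟ c
  ... | yes refl = sym (trans (∨-identityʳ (Z j)) (≢true⇒≡false λ Zc → true≢false (trans (sym Bc) (Z∩B≡∅ j Zc))))
  ... | no _     = refl

iso⇒Indep⇔LinIndepᶠ : ∀ {r n} {M : Matroid n} {A : Matrix r n} → ((π , _) : IsoToColumnMatroid M A) →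
  ∀ X → Indep M X ⇔ LinIndepᶠ A (λ j → lookup X (π ⟨$⟩ˡ j))
iso⇒Indep⇔LinIndepᶠ {A = A} (π , iso) X =
  ⇔.trans (iso X) (⇔.trans (LinIndep⇔LinIndepᶠ A (image π X))
                           (LinIndepᶠ-cong A (lookup∘tabulate (λ j → lookup X (π ⟨$⟩ˡ j)))))

Indep⇔LinIndepᶠ⇒iso : ∀ {r n} {M : Matroid n} (A : Matrix r n) →
  (∀ X → Indep M X ⇔ LinIndepᶠ A (lookup X)) → IsoToColumnMatroid M A
Indep⇔LinIndepᶠ⇒iso A M≅A = idₚ , λ X →
  ⇔.trans (M≅A X) (⇔.trans (LinIndepᶠ-cong A (λ j → sym (lookup∘tabulate (lookup X) j)))
                           (⇔.sym (LinIndep⇔LinIndepᶠ A (image idₚ X))))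

push-isImage : ∀ {m n} (φ : Fin m → Fin n) → Injective _≡_ _≡_ φ → (X : Subset m) →
  IsImage φ X (tabulate (push φ (lookup X)))
push-isImage φ φ-inj X e = mk⇔
  (λ e∈ → let (x , Xx , φx≡e) = push-true⁻ φ (lookup X) e
                                  (trans (sym (lookup∘tabulate (push φ (lookup X)) e)) (∈⇒lookup e∈))
          in x , lookup⇒∈ Xx , φx≡e)
  (λ { (x , x∈X , refl) → lookup⇒∈ (trans (lookup∘tabulate (push φ (lookup X)) (φ x))
                                          (push-true φ φ-inj (lookup X) (∈⇒lookup x∈X))) })

minor-closed : ∀ {m n} (N : Matroid m) (M : Matroid n) → IsMinorOf N M → InMvΦY1 M → InMvΦY1 N
minor-closed {m} {n} N M (_ , _ , φ , B , _ , φ-inj , φ-range , (B⊆C , indB , _) , N≅M/C\D) (r , A , conf , M≅A) =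
  r , Aψ , ⇒conforms Aψ (λ x → conf′ (ψ x)) , Indep⇔LinIndepᶠ⇒iso {M = N} Aψ N≅Aψ
  where
  π = proj₁ M≅A
  inA : Subset n → Fin n → Bool
  inA X j = lookup X (π ⟨$⟩ˡ j)
  contraction = contract-independent (count (inA B)) A (inA B) ≤-refl (conforms⇒ A conf)
                  (Equivalence.to (iso⇒Indep⇔LinIndepᶠ {M = M} M≅A B) indB)
  A′ = proj₁ contraction
  conf′ = proj₁ (proj₂ contraction)
  ψ : Fin m → Fin n
  ψ x = π ⟨$⟩ʳ φ x
  φ-injective : Injective _≡_ _≡_ φ
  φ-injective = φ-inj _ _
  ψ-inj : Injective _≡_ _≡_ ψ
  ψ-inj ψx≡ψy = φ-injective (trans (sym (inverseˡ π)) (trans (cong (π ⟨$⟩ˡ_) ψx≡ψy) (inverseˡ π)))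
  Aψ : Matrix (2 + r) m
  Aψ i x = A′ i (ψ x)
  N≅Aψ : ∀ X → Indep N X ⇔ LinIndepᶠ Aψ (lookup X)
  N≅Aψ X =
    ⇔.trans (N≅M/C\D X φX (push-isImage φ φ-injective X))
   (⇔.trans (iso⇒Indep⇔LinIndepᶠ {M = M} M≅A (φX ∪ B))
   (⇔.trans (LinIndepᶠ-cong A (λ j → lookup-zipWith _∨_ (π ⟨$⟩ˡ j) φX B))
   (⇔.trans (proj₂ (proj₂ contraction) (inA φX) disjoint)
            (Reindexing.LinIndepᶠ-reindex A′ ψ ψ-inj (lookup X) (inA φX) φX⊆ψX ψX⊆φX))))
    where
    φX = tabulate (push φ (lookup X))
    φX-true⁻ : ∀ j → inA φX j ≡ true → ∃[ x ] (lookup X x ≡ true × φ x ≡ π ⟨$⟩ˡ j)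
    φX-true⁻ j e = push-true⁻ φ (lookup X) (π ⟨$⟩ˡ j) (trans (sym (lookup∘tabulate _ (π ⟨$⟩ˡ j))) e)
    disjoint : Disjointᶠ (inA φX) (inA B)
    disjoint j e = ≢true⇒≡false λ Bj →
      let (x , _ , φx≡j) = φX-true⁻ j e in proj₁ (Equivalence.to (φ-range _) (x , φx≡j)) (B⊆C (lookup⇒∈ Bj))
    φX⊆ψX : ∀ j → inA φX j ≡ true → ∃[ x ] (lookup X x ≡ true × ψ x ≡ j)
    φX⊆ψX j e = let (x , Xx , φx≡j) = φX-true⁻ j e in x , Xx , trans (cong (π ⟨$⟩ʳ_) φx≡j) (inverseʳ π)
    ψX⊆φX : ∀ x → lookup X x ≡ true → inA φX (ψ x) ≡ true
    ψX⊆φX x Xx = trans (cong (lookup φX) (inverseˡ π))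
                       (trans (lookup∘tabulate _ (φ x)) (push-true φ φ-injective (lookup X) Xx))

-- From a template matrix to an even-cycle representation

data Shape {r} (x₁ x₂ : Bool) (g : Fin r → Bool) : Set where
  none : (∀ i → g i ≡ false) → Shape x₁ x₂ g
  one  : ∀ k → (∀ i → g i ≡ (i ≡ᵇ k)) → Shape x₁ x₂ g
  two  : ∀ k k′ → x₁ ≡ false → x₂ ≡ false → (∀ i → g i ≡ (i ≡ᵇ k) xor (i ≡ᵇ k′)) → Shape x₁ x₂ g

remove≗0⇒≗δ : ∀ {r} {g : Fin r → Bool} {k} → g k ≡ true → (∀ i → remove g k i ≡ false) →
  ∀ i → g i ≡ (i ≡ᵇ k)
remove≗0⇒≗δ {g = g} {k} gk rest≗0 i with i ≟ k
... | yes refl = gk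
... | no i≢k   = trans (sym (remove-≢ g i≢k)) (rest≗0 i)

remove²≗0⇒≗δ+δ : ∀ {r} {g : Fin r → Bool} {k k′} → g k ≡ true → remove g k k′ ≡ true →
  (∀ i → remove (remove g k) k′ i ≡ false) → ∀ i → g i ≡ (i ≡ᵇ k) xor (i ≡ᵇ k′)
remove²≗0⇒≗δ+δ {g = g} {k} {k′} gk gk′ rest≗0 i with i ≟ k | i ≟ k′
... | yes refl | yes refl = ⊥-elim (proj₁ (remove-true⁻ g k k gk′) refl)
... | yes refl | no _     = gk
... | no _     | yes refl = proj₂ (remove-true⁻ g k k′ gk′)
... | no i≢k   | no i≢k′  = trans (sym (trans (remove-≢ (remove g k) i≢k′) (remove-≢ g i≢k))) (rest≗0 i)

shape : ∀ {r} {x₁ x₂ : Bool} {g : Fin r → Bool} → TemplateColumn x₁ x₂ g → Shape x₁ x₂ g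
shape {g = g} (inj₂ (_ , ≤1)) with true-or-all-false g
... | inj₂ g≗0      = none g≗0
... | inj₁ (k , gk) = one k (remove≗0⇒≗δ gk (AtMostOne-remove ≤1 gk))
shape {g = g} (inj₁ (x₁≡0 , x₂≡0 , ≤2)) with true-or-all-false g
... | inj₂ g≗0      = none g≗0
... | inj₁ (k , gk) with true-or-all-false (remove g k)
...   | inj₂ rest≗0     = one k (remove≗0⇒≗δ gk rest≗0)
...   | inj₁ (k′ , gk′) = two k k′ x₁≡0 x₂≡0 (remove²≗0⇒≗δ+δ gk gk′ (AtMostTwo-remove² ≤2 gk gk′))

Σ₂-≗δ : ∀ {r} {g : Fin r → Bool} {k} → (∀ i → g i ≡ (i ≡ᵇ k)) → Σ₂ g ≡ true
Σ₂-≗δ {g = g} {k} g≗δ =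
  trans (Σ₂-cong (λ i → trans (g≗δ i) (sym (∧-identityʳ (i ≡ᵇ k))))) (Σ₂-δ k (λ _ → true))

-- Vertex 0 carries row x₂, vertex 1 the sum of row x₂ and the rows R (making every column even),
-- and vertex 2 + i carries row i of R.
templateRow : ∀ {r} → Bool → (Fin r → Bool) → Fin (2 + r) → Bool
templateRow x₂ g zero          = x₂
templateRow x₂ g (suc zero)    = x₂ xor Σ₂ g
templateRow x₂ g (suc (suc i)) = g i

side : ∀ {r} → Bool → Fin (2 + r)
side true  = zero
side false = suc zero

endpoint₁ : ∀ {r x₁ x₂} {g : Fin r → Bool} → Shape x₁ x₂ g → Fin (2 + r)
endpoint₁ {x₂ = x₂} (none _)   = side x₂
endpoint₁ {x₂ = x₂} (one _ _)  = side x₂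
endpoint₁ (two k _ _ _ _)      = suc (suc k)

endpoint₂ : ∀ {r x₁ x₂} {g : Fin r → Bool} → Shape x₁ x₂ g → Fin (2 + r)
endpoint₂ (none _)         = suc zero
endpoint₂ (one k _)        = suc (suc k)
endpoint₂ (two _ k′ _ _ _) = suc (suc k′)

endpoints-incidence : ∀ {r x₁ x₂} {g : Fin r → Bool} (s : Shape x₁ x₂ g) x →
  (x ≡ᵇ endpoint₁ s) xor (x ≡ᵇ endpoint₂ s) ≡ templateRow x₂ g x
endpoints-incidence {x₂ = true}  (none g≗0) zero          = refl
endpoints-incidence {x₂ = false} (none g≗0) zero          = refl
endpoints-incidence {x₂ = true}  (none g≗0) (suc zero)    = sym (cong (true xor_) (Σ₂-zero g≗0))
endpoints-incidence {x₂ = false} (none g≗0) (suc zero)    = sym (Σ₂-zero g≗0)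
endpoints-incidence {x₂ = true}  (none g≗0) (suc (suc i)) = sym (g≗0 i)
endpoints-incidence {x₂ = false} (none g≗0) (suc (suc i)) = sym (g≗0 i)
endpoints-incidence {x₂ = true}  (one k g≗δ) zero          = refl
endpoints-incidence {x₂ = false} (one k g≗δ) zero          = refl
endpoints-incidence {x₂ = true}  (one k g≗δ) (suc zero)    = sym (cong (true xor_) (Σ₂-≗δ g≗δ))
endpoints-incidence {x₂ = false} (one k g≗δ) (suc zero)    = sym (Σ₂-≗δ g≗δ)
endpoints-incidence {x₂ = true}  (one k g≗δ) (suc (suc i)) = sym (g≗δ i)
endpoints-incidence {x₂ = false} (one k g≗δ) (suc (suc i)) = sym (g≗δ i)
endpoints-incidence (two k k′ _ refl g≗δ+δ) zero          = refl
endpoints-incidence (two k k′ _ refl g≗δ+δ) (suc zero)    =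
  sym (trans (Σ₂-cong g≗δ+δ) (trans (Σ₂-xor (_≡ᵇ k) (_≡ᵇ k′))
                                    (cong₂ _xor_ (Σ₂-≗δ {k = k} (λ _ → refl)) (Σ₂-≗δ {k = k′} (λ _ → refl)))))
endpoints-incidence (two k k′ _ refl g≗δ+δ) (suc (suc i)) = sym (g≗δ+δ i)

odd-endpoint₁ : ∀ {r x₁ x₂} {g : Fin r → Bool} (s : Shape x₁ x₂ g) → x₁ ≡ true →
  endpoint₁ s ≡ zero ⊎ endpoint₁ s ≡ suc zero
odd-endpoint₁ {x₂ = true}  (none _)          _    = inj₁ refl
odd-endpoint₁ {x₂ = false} (none _)          _    = inj₂ refl
odd-endpoint₁ {x₂ = true}  (one _ _)         _    = inj₁ refl
odd-endpoint₁ {x₂ = false} (one _ _)         _    = inj₂ refl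
odd-endpoint₁              (two _ _ refl _ _) ()

inject₁-or-last : ∀ {m} (i : Fin (suc m)) → (∃[ i′ ] i ≡ inject₁ i′) ⊎ i ≡ fromℕ m
inject₁-or-last {zero}  zero    = inj₂ refl
inject₁-or-last {suc m} zero    = inj₁ (zero , refl)
inject₁-or-last {suc m} (suc i) with inject₁-or-last i
... | inj₁ (i′ , i≡i′) = inj₁ (suc i′ , cong suc i≡i′)
... | inj₂ i≡last      = inj₂ (cong suc i≡last)

cycle-end₁ : ∀ {v n} {G : Graph v n} (C : Cycle G) i → ∃[ k ] vs C k ≡ end₁ G (es C i)
cycle-end₁ {G = G} C i = end₁-on (edge-on-cycle i)
  where
  edge-on-cycle : ∀ i → ∃[ k ] ∃[ k′ ] Joins G (es C i) (vs C k) (vs C k′)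
  edge-on-cycle i with inject₁-or-last i
  ... | inj₁ (i′ , refl) = inject₁ i′ , suc i′ , step C i′
  ... | inj₂ refl        = fromℕ (len C) , zero , close C
  end₁-on : (∃[ k ] ∃[ k′ ] Joins G (es C i) (vs C k) (vs C k′)) → ∃[ k ] vs C k ≡ end₁ G (es C i)
  end₁-on (k , _  , inj₁ (end₁≡ , _)) = k  , sym end₁≡
  end₁-on (_ , k′ , inj₂ (end₁≡ , _)) = k′ , sym end₁≡

module TemplateGraph {r n} (A : Matrix (2 + r) n) (conf : ∀ j → Conforms A j) where

  shapeOf : ∀ j → Shape (A zero j) (A (suc zero) j) (rowsR A j)
  shapeOf j = shape (conf j)

  G : Graph (2 + r) n
  G = record { end₁ = λ j → endpoint₁ (shapeOf j) ; end₂ = λ j → endpoint₂ (shapeOf j) }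

  W : Subset n
  W = tabulate (λ j → A zero j)

  E : Matrix (suc (2 + r)) n
  E = ecMatrix G W

  E-row : ∀ x j → E (suc x) j ≡ templateRow (A (suc zero) j) (rowsR A j) x
  E-row x j = endpoints-incidence (shapeOf j) x

  Ker-A⇒E : ∀ Y → Ker A Y → Ker E Y
  Ker-A⇒E Y Y∈Ker zero = trans (dot-congʳ Y (lookup∘tabulate (λ j → A zero j))) (Y∈Ker zero)
  Ker-A⇒E Y Y∈Ker (suc zero) = trans (dot-congʳ Y (E-row zero)) (Y∈Ker (suc zero))
  Ker-A⇒E Y Y∈Ker (suc (suc zero)) = begin
    dot Y (λ j → E (suc (suc zero)) j)
      ≡⟨ dot-congʳ Y (E-row (suc zero)) ⟩
    dot Y (λ j → A (suc zero) j xor Σ₂ (rowsR A j))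
      ≡⟨ dot-xor Y (A (suc zero)) _ ⟩
    colSumᶠ A Y (suc zero) xor dot Y (λ j → Σ₂ (rowsR A j))
      ≡⟨ cong₂ _xor_ (Y∈Ker (suc zero))
        (dot-Σ₂ Y (λ _ → true) (λ i → A (suc (suc i)))) ⟩
    Σ₂ (λ i → colSumᶠ A Y (suc (suc i)))
      ≡⟨ Σ₂-zero (λ i → Y∈Ker (suc (suc i))) ⟩
    false ∎
    where open ≡-Reasoning
  Ker-A⇒E Y Y∈Ker (suc (suc (suc i))) = trans (dot-congʳ Y (E-row (suc (suc i)))) (Y∈Ker (suc (suc i)))

  Ker-E⇒A : ∀ Y → Ker E Y → Ker A Y
  Ker-E⇒A Y Y∈Ker zero          = trans (sym (dot-congʳ Y (lookup∘tabulate (λ j → A zero j)))) (Y∈Ker zero)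
  Ker-E⇒A Y Y∈Ker (suc zero)    = trans (sym (dot-congʳ Y (E-row zero))) (Y∈Ker (suc zero))
  Ker-E⇒A Y Y∈Ker (suc (suc i)) = trans (sym (dot-congʳ Y (E-row (suc (suc i))))) (Y∈Ker (suc (suc (suc i))))

  blocking : IsBlockingPair G W zero (suc zero)
  blocking = (λ ()) , through-odd-edge
    where
    through-odd-edge : ∀ C → OddCycle G W C → PassesThrough C zero ⊎ PassesThrough C (suc zero)
    through-odd-edge C odd with Σ₂-true⇒∃ _ (Equivalence.to (odd-weight⇔Σ₂ (λ i → lookup W (es C i))) odd)
    ... | i , e∈W with cycle-end₁ C i
    ...   | k , vk≡end₁ = [ inj₁ ∘ (k ,_) ∘ trans vk≡end₁ , inj₂ ∘ (k ,_) ∘ trans vk≡end₁ ]′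
                            (odd-endpoint₁ (shapeOf (es C i)) odd-column)
      where
      odd-column : A zero (es C i) ≡ true
      odd-column = trans (sym (lookup∘tabulate (λ j → A zero j) (es C i))) e∈W

template⇒ecr : ∀ {n} (M : Matroid n) → InMvΦY1 M → IsBinary M × HasECRWithBlockingPair M
template⇒ecr M (r , A , conf , M≅A) =
  (2 + r , A , M≅A) ,
  (2 + r , G , W , (zero , suc zero , blocking) , sameKer⇒iso {M = M} A E Ker-A⇒E Ker-E⇒A M≅A)
  where open TemplateGraph A (conforms⇒ A conf)

-- Paths, cycles and the signing of a graph with a blocking pair

module Paths {v n} (G : Graph v n) where

  data Path : Fin v → Fin v → Set where
    nil  : ∀ x → Path x x
    cons : ∀ {x y z} (e : Fin n) → Joins G e x y → Path y z → Path x z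

  inner : ∀ {x z} → Path x z → List (Fin v)
  inner (nil x)              = []
  inner (cons {y = y} _ _ p) = y ∷ inner p

  vertices : ∀ {x z} → Path x z → List (Fin v)
  vertices {x} p = x ∷ inner p

  edges : ∀ {x z} → Path x z → List (Fin n)
  edges (nil x)      = []
  edges (cons e _ p) = e ∷ edges p

  pathSum : (Fin n → Bool) → ∀ {x z} → Path x z → Bool
  pathSum w (nil x)      = false
  pathSum w (cons e _ p) = w e xor pathSum w p

  _++ₚ_ : ∀ {x y z} → Path x y → Path y z → Path x z
  nil x      ++ₚ q = q
  cons e j p ++ₚ q = cons e j (p ++ₚ q)

  inner-++ₚ : ∀ {x y z} (p : Path x y) (q : Path y z) → inner (p ++ₚ q) ≡ inner p ++ inner q
  inner-++ₚ (nil x)      q = refl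
  inner-++ₚ (cons e j p) q = cong (_ ∷_) (inner-++ₚ p q)

  edges-++ₚ : ∀ {x y z} (p : Path x y) (q : Path y z) → edges (p ++ₚ q) ≡ edges p ++ edges q
  edges-++ₚ (nil x)      q = refl
  edges-++ₚ (cons e j p) q = cong (e ∷_) (edges-++ₚ p q)

  pathSum-++ₚ : ∀ w {x y z} (p : Path x y) (q : Path y z) → pathSum w (p ++ₚ q) ≡ pathSum w p xor pathSum w q
  pathSum-++ₚ w (nil x)      q = refl
  pathSum-++ₚ w (cons e j p) q =
    trans (cong (w e xor_) (pathSum-++ₚ w p q)) (sym (xor-assoc (w e) (pathSum w p) (pathSum w q)))

  -- A path t ⇝ u closed by an edge e₀ joining u and t; position i lists the i-th vertex and the
  -- edge leaving it, the last position carrying e₀.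
  vertexAt : ∀ {x z} (p : Path x z) → Fin (suc (length (inner p))) → Fin v
  vertexAt (nil x)            zero    = x
  vertexAt (cons {x} e j p)   zero    = x
  vertexAt (cons e j p)       (suc i) = vertexAt p i

  edgeAt : ∀ {x z} (p : Path x z) → Fin n → Fin (suc (length (inner p))) → Fin n
  edgeAt (nil x)      e₀ zero    = e₀
  edgeAt (cons e j p) e₀ zero    = e
  edgeAt (cons e j p) e₀ (suc i) = edgeAt p e₀ i

  vertexAt-first : ∀ {x z} (p : Path x z) → vertexAt p zero ≡ x
  vertexAt-first (nil x)      = refl
  vertexAt-first (cons e j p) = refl

  vertexAt-last : ∀ {x z} (p : Path x z) → vertexAt p (fromℕ (length (inner p))) ≡ z
  vertexAt-last (nil x)      = refl
  vertexAt-last (cons e j p) = vertexAt-last p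

  edgeAt-last : ∀ {x z} (p : Path x z) e₀ → edgeAt p e₀ (fromℕ (length (inner p))) ≡ e₀
  edgeAt-last (nil x)      e₀ = refl
  edgeAt-last (cons e j p) e₀ = edgeAt-last p e₀

  All-vertexAt : ∀ {P : Fin v → Set} {x z} (p : Path x z) → All P (vertices p) → ∀ i → P (vertexAt p i)
  All-vertexAt (nil x)      (px ∷ _)  zero    = px
  All-vertexAt (cons e j p) (px ∷ _)  zero    = px
  All-vertexAt (cons e j p) (_ ∷ pxs) (suc i) = All-vertexAt p pxs i

  All-edgeAt : ∀ {P : Fin n → Set} {x z} (p : Path x z) e₀ → All P (edges p) → P e₀ → ∀ i → P (edgeAt p e₀ i)
  All-edgeAt (nil x)      e₀ _         pe₀ zero    = pe₀
  All-edgeAt (cons e j p) e₀ (pe ∷ _)  pe₀ zero    = pe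
  All-edgeAt (cons e j p) e₀ (_ ∷ pes) pe₀ (suc i) = All-edgeAt p e₀ pes pe₀ i

  vertexAt-injective : ∀ {x z} (p : Path x z) → Unique (vertices p) →
    ∀ i k → vertexAt p i ≡ vertexAt p k → i ≡ k
  vertexAt-injective (nil x)      _        zero    zero    _  = refl
  vertexAt-injective (cons e j p) _        zero    zero    _  = refl
  vertexAt-injective (cons e j p) (x∉ ∷ _) zero    (suc k) eq = ⊥-elim (All-vertexAt p x∉ k eq)
  vertexAt-injective (cons e j p) (x∉ ∷ _) (suc i) zero    eq = ⊥-elim (All-vertexAt p x∉ i (sym eq))
  vertexAt-injective (cons e j p) (_ ∷ u)  (suc i) (suc k) eq = cong suc (vertexAt-injective p u i k eq)

  edgeAt-injective : ∀ {x z} (p : Path x z) e₀ → Unique (edges p) → All (_≢ e₀) (edges p) →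
    ∀ i k → edgeAt p e₀ i ≡ edgeAt p e₀ k → i ≡ k
  edgeAt-injective (nil x)      e₀ _        _          zero    zero    _  = refl
  edgeAt-injective (cons e j p) e₀ _        _          zero    zero    _  = refl
  edgeAt-injective (cons e j p) e₀ (e∉ ∷ _) (e≢e₀ ∷ _) zero    (suc k) eq = ⊥-elim (All-edgeAt p e₀ e∉ e≢e₀ k eq)
  edgeAt-injective (cons e j p) e₀ (e∉ ∷ _) (e≢e₀ ∷ _) (suc i) zero    eq = ⊥-elim (All-edgeAt p e₀ e∉ e≢e₀ i (sym eq))
  edgeAt-injective (cons e j p) e₀ (_ ∷ u)  (_ ∷ ≢e₀)  (suc i) (suc k) eq = cong suc (edgeAt-injective p e₀ u ≢e₀ i k eq)

  edgeAt-step : ∀ {x z} (p : Path x z) e₀ (i : Fin (length (inner p))) →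
    Joins G (edgeAt p e₀ (inject₁ i)) (vertexAt p (inject₁ i)) (vertexAt p (suc i))
  edgeAt-step (cons e j p) e₀ zero    = subst (Joins G e _) (sym (vertexAt-first p)) j
  edgeAt-step (cons e j p) e₀ (suc i) = edgeAt-step p e₀ i

  Σ₂-edgeAt : ∀ w {x z} (p : Path x z) e₀ → Σ₂ (λ i → w (edgeAt p e₀ i)) ≡ pathSum w p xor w e₀
  Σ₂-edgeAt w (nil x)      e₀ = xor-identityʳ (w e₀)
  Σ₂-edgeAt w (cons e j p) e₀ =
    trans (cong (w e xor_) (Σ₂-edgeAt w p e₀)) (sym (xor-assoc (w e) (pathSum w p) (w e₀)))

  closeCycle : ∀ {t u} (p : Path t u) e₀ → Unique (vertices p) → Unique (edges p) →
    All (_≢ e₀) (edges p) → Joins G e₀ u t → Cycle G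
  closeCycle p e₀ uv ue ≢e₀ j = record
    { len    = length (inner p)
    ; vs     = vertexAt p
    ; es     = edgeAt p e₀
    ; vs-inj = vertexAt-injective p uv
    ; es-inj = edgeAt-injective p e₀ ue ≢e₀
    ; step   = edgeAt-step p e₀
    ; close  = subst₂ (λ e x → Joins G e x (vertexAt p zero)) (sym (edgeAt-last p e₀)) (sym (vertexAt-last p))
                 (subst (Joins G e₀ _) (sym (vertexAt-first p)) j)
    }

module Signing {v n} (G : Graph v n) (W : Subset n) (a b : Fin v) where

  open Paths G

  w : Fin n → Bool
  w = lookup W

  OffPair : Fin v → Set
  OffPair x = x ≢ a × x ≢ b

  InnerEdge : Fin n → Set
  InnerEdge e = OffPair (end₁ G e) × OffPair (end₂ G e)

  OffPair? : ∀ x → Dec (OffPair x)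
  OffPair? x = ¬? (x ≟ a) ×-dec ¬? (x ≟ b)

  InnerEdge? : ∀ e → Dec (InnerEdge e)
  InnerEdge? e = OffPair? (end₁ G e) ×-dec OffPair? (end₂ G e)

  record GoodPath (k : ℕ) (L : Fin v → Fin v) (s : Fin v → Bool) {x y} (p : Path x y) : Set where
    field
      vertices-unique : Unique (vertices p)
      edges-unique    : Unique (edges p)
      vertices-in     : All (λ z → L z ≡ L x) (vertices p)
      edges-in        : All (λ e → L (end₁ G e) ≡ L x × toℕ e < k) (edges p)
      inner-off       : All OffPair (inner p)
      pathSum≡        : pathSum w p ≡ s x xor s y
  open GoodPath

  -- The state after the edges of index < k have been scanned: L labels the components of the
  -- inner edges scanned so far, and s is a signing of those edges, certified along connecting paths.
  record Partial (k : ℕ) : Set where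
    field
      L          : Fin v → Fin v
      s          : Fin v → Bool
      consistent : ∀ e → toℕ e < k → InnerEdge e →
                   L (end₁ G e) ≡ L (end₂ G e) × w e ≡ s (end₁ G e) xor s (end₂ G e)
      connected  : ∀ x y → L x ≡ L y → Σ (Path x y) (GoodPath k L s)
  open Partial

  partial₀ : Partial 0
  partial₀ = record { L = λ x → x ; s = λ _ → false ; consistent = λ _ () ; connected = trivial }
    where
    trivial : ∀ x y → x ≡ y → Σ (Path x y) (GoodPath 0 (λ x → x) (λ _ → false))
    trivial x .x refl = nil x , record
      { vertices-unique = [] ∷ [] ; edges-unique = [] ; vertices-in = refl ∷ [] ; edges-in = []
      ; inner-off = [] ; pathSum≡ = refl }

  GoodPath-keep : ∀ {k L s L′ s′ x y} (p : Path x y) → GoodPath k L s p →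
    (∀ z → L z ≡ L x → L′ z ≡ L′ x) → s x xor s y ≡ s′ x xor s′ y → GoodPath (suc k) L′ s′ p
  GoodPath-keep p good L′-same s′-diff = record
    { vertices-unique = vertices-unique good
    ; edges-unique    = edges-unique good
    ; vertices-in     = All-map (L′-same _) (vertices-in good)
    ; edges-in        = All-map (λ (same , e<k) → L′-same _ same , m<n⇒m<1+n e<k) (edges-in good)
    ; inner-off       = inner-off good
    ; pathSum≡        = trans (pathSum≡ good) s′-diff
    }

  GoodPath-join : ∀ {k L s L′ s′ x p q y} (P₁ : Path x p) e (j : Joins G e p q) (P₂ : Path q y) →
    GoodPath k L s P₁ → GoodPath k L s P₂ → toℕ e ≡ k → OffPair q → L x ≢ L q →
    ∀ ℓ → L′ x ≡ ℓ → (∀ z → L z ≡ L x → L′ z ≡ ℓ) → (∀ z → L z ≡ L q → L′ z ≡ ℓ) →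
    L′ (end₁ G e) ≡ ℓ → pathSum w P₁ xor (w e xor pathSum w P₂) ≡ s′ x xor s′ y →
    GoodPath (suc k) L′ s′ (P₁ ++ₚ cons e j P₂)
  GoodPath-join {k} {L} {s} {L′} {s′} {x} {p} {q} {y} P₁ e j P₂ good₁ good₂ e≡k q-off Lx≢Lq
                ℓ L′x≡ℓ L′₁ L′₂ L′e≡ℓ sum≡ = record
    { vertices-unique = subst (λ l → Unique (x ∷ l)) (sym (inner-++ₚ P₁ (cons e j P₂)))
        (Unique.++⁺ (vertices-unique good₁) (vertices-unique good₂)
          λ (z∈₁ , z∈₂) → Lx≢Lq (trans (sym (All-lookup (vertices-in good₁) z∈₁))
                                       (All-lookup (vertices-in good₂) z∈₂)))
    ; edges-unique = subst Unique (sym (edges-++ₚ P₁ (cons e j P₂)))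
        (Unique.++⁺ (edges-unique good₁)
          (All-map (λ (_ , e′<k) e≡e′ → <-irrefl (trans (cong toℕ (sym e≡e′)) e≡k) e′<k) (edges-in good₂)
             ∷ edges-unique good₂)
          disjoint-edges)
    ; vertices-in = subst (λ l → All (λ z → L′ z ≡ L′ x) (x ∷ l)) (sym (inner-++ₚ P₁ (cons e j P₂)))
        (All.++⁺ (All-map (λ {z} same → trans (L′₁ z same) (sym L′x≡ℓ)) (vertices-in good₁))
                 (All-map (λ {z} same → trans (L′₂ z same) (sym L′x≡ℓ)) (vertices-in good₂)))
    ; edges-in = subst (All (λ e′ → L′ (end₁ G e′) ≡ L′ x × toℕ e′ < suc k)) (sym (edges-++ₚ P₁ (cons e j P₂)))
        (All.++⁺ (All-map (λ (same , e′<k) → trans (L′₁ _ same) (sym L′x≡ℓ) , m<n⇒m<1+n e′<k) (edges-in good₁))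
                 ((trans L′e≡ℓ (sym L′x≡ℓ) , subst (_< suc k) (sym e≡k) ≤-refl)
                  ∷ All-map (λ (same , e′<k) → trans (L′₂ _ same) (sym L′x≡ℓ) , m<n⇒m<1+n e′<k) (edges-in good₂)))
    ; inner-off = subst (All OffPair) (sym (inner-++ₚ P₁ (cons e j P₂)))
        (All.++⁺ (inner-off good₁) (q-off ∷ inner-off good₂))
    ; pathSum≡ = trans (pathSum-++ₚ w P₁ (cons e j P₂)) sum≡
    }
    where
    disjoint-edges : ∀ {e′} → ¬ (e′ ∈ˡ edges P₁ × e′ ∈ˡ (e ∷ edges P₂))
    disjoint-edges (e′∈₁ , here refl) = <-irrefl e≡k (proj₂ (All-lookup (edges-in good₁) e′∈₁))
    disjoint-edges (e′∈₁ , there e′∈₂) =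
      Lx≢Lq (trans (sym (proj₁ (All-lookup (edges-in good₁) e′∈₁))) (proj₁ (All-lookup (edges-in good₂) e′∈₂)))

  extend-keep : ∀ {k} (P : Partial k) e → toℕ e ≡ k →
    (InnerEdge e → L P (end₁ G e) ≡ L P (end₂ G e) × w e ≡ s P (end₁ G e) xor s P (end₂ G e)) → Partial (suc k)
  extend-keep P e e≡k e-ok = record
    { L = L P ; s = s P ; consistent = consistent′
    ; connected = λ x y same → let (p , good) = connected P x y same in p , GoodPath-keep p good (λ _ z≡ → z≡) refl }
    where
    consistent′ : ∀ e′ → toℕ e′ < suc _ → InnerEdge e′ → _
    consistent′ e′ e′≤k inner with m<1+n⇒m<n∨m≡n e′≤k
    ... | inj₁ e′<k = consistent P e′ e′<k inner
    ... | inj₂ e′≡k with toℕ-injective (trans e′≡k (sym e≡k))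
    ...   | refl = e-ok inner

  -- The new inner edge e joins two components: relabel the component of t = end₂ e as that of
  -- u = end₁ e and flip the signs on it by δ, so that e becomes consistent.
  module Merge {k} (P : Partial k) (e : Fin n) (e≡k : toℕ e ≡ k) (e-inner : InnerEdge e)
               (Lu≢Lt : L P (end₁ G e) ≢ L P (end₂ G e)) where

    u t : Fin v
    u = end₁ G e
    t = end₂ G e

    relabel : Fin v → Fin v
    relabel ℓ = if ℓ ≡ᵇ L P t then L P u else ℓ

    δ : Bool
    δ = (w e xor s P u) xor s P t

    L′ : Fin v → Fin v
    L′ z = relabel (L P z)

    s′ : Fin v → Bool
    s′ z = s P z xor ((L P z ≡ᵇ L P t) ∧ δ)

    module _ {z : Fin v} where

      L′-out : L P z ≢ L P t → L′ z ≡ L P z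
      L′-out ≢t rewrite ≢⇒≡ᵇ-false ≢t = refl

      L′-in : L P z ≡ L P t → L′ z ≡ L P u
      L′-in ≡t rewrite ≡t | ≡ᵇ-refl (L P t) = refl

      s′-out : L P z ≢ L P t → s′ z ≡ s P z
      s′-out ≢t rewrite ≢⇒≡ᵇ-false ≢t = xor-identityʳ (s P z)

      s′-in : L P z ≡ L P t → s′ z ≡ s P z xor δ
      s′-in ≡t rewrite ≡t | ≡ᵇ-refl (L P t) = refl

    L′u : L′ u ≡ L P u
    L′u = L′-out Lu≢Lt

    consistent′ : ∀ e′ → toℕ e′ < suc k → InnerEdge e′ →
      L′ (end₁ G e′) ≡ L′ (end₂ G e′) × w e′ ≡ s′ (end₁ G e′) xor s′ (end₂ G e′)
    consistent′ e′ e′≤k inner with m<1+n⇒m<n∨m≡n e′≤k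
    ... | inj₁ e′<k = cong relabel same , (begin
      w e′
        ≡⟨ w≡ ⟩
      s P u′ xor s P t′
        ≡⟨ solve 3 (λ x y c → x :+ y := (x :+ c) :+ (y :+ c)) refl
          (s P u′) (s P t′) (flip u′) ⟩
      (s P u′ xor flip u′) xor (s P t′ xor flip u′)
        ≡⟨ cong (λ ℓ → s′ u′ xor (s P t′ xor ((ℓ ≡ᵇ L P t) ∧ δ))) same ⟩
      s′ u′ xor s′ t′ ∎)
      where
      open ≡-Reasoning
      u′ = end₁ G e′
      t′ = end₂ G e′
      flip : Fin v → Bool
      flip z = (L P z ≡ᵇ L P t) ∧ δ
      same = proj₁ (consistent P e′ e′<k inner)
      w≡ = proj₂ (consistent P e′ e′<k inner)
    ... | inj₂ e′≡k with toℕ-injective (trans e′≡k (sym e≡k))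
    ...   | refl = trans L′u (sym (L′-in refl)) ,
      trans (solve 3 (λ we su st → we := su :+ (st :+ ((we :+ su) :+ st))) refl (w e) (s P u) (s P t))
            (sym (cong₂ _xor_ L′u′ (s′-in refl)))
      where
      L′u′ : s′ u ≡ s P u
      L′u′ = s′-out Lu≢Lt

    keep-path : ∀ x y → L P x ≡ L P y → s P x xor s P y ≡ s′ x xor s′ y →
      Σ (Path x y) (GoodPath (suc k) L′ s′)
    keep-path x y same s≡ = let (p , good) = connected P x y same in
      p , GoodPath-keep p good (λ z → cong relabel) s≡

    through-e : ∀ x y → L P x ≢ L P t → L P y ≡ L P t → L P x ≡ L P u →
      Σ (Path x y) (GoodPath (suc k) L′ s′)
    through-e x y x-out y-in Lx≡Lu =
      P₁ ++ₚ cons e (inj₁ (refl , refl)) P₂ ,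
      GoodPath-join P₁ e _ P₂ good₁ good₂ e≡k (proj₂ e-inner) x-out (L P u)
        (trans (L′-out x-out) Lx≡Lu)
        (λ z same → trans (L′-out (λ z-in → x-out (trans (sym same) z-in))) (trans same Lx≡Lu))
        (λ z same → L′-in same)
        L′u
        (begin
          pathSum w P₁ xor (w e xor pathSum w P₂)
            ≡⟨ cong₂ (λ p₁ p₂ → p₁ xor (w e xor p₂)) (pathSum≡ good₁) (pathSum≡ good₂) ⟩
          (s P x xor s P u) xor (w e xor (s P t xor s P y))
            ≡⟨ solve 5 (λ x u we t y → (x :+ u) :+ (we :+ (t :+ y)) := x :+ (y :+ ((we :+ u) :+ t)))
              refl (s P x) (s P u) (w e) (s P t) (s P y) ⟩
          s P x xor (s P y xor δ)
            ≡⟨ cong₂ _xor_ (s′-out x-out) (s′-in y-in) ⟨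
          s′ x xor s′ y ∎)
      where
      open ≡-Reasoning
      P₁ = proj₁ (connected P x u Lx≡Lu)
      good₁ = proj₂ (connected P x u Lx≡Lu)
      P₂ = proj₁ (connected P t y (sym y-in))
      good₂ = proj₂ (connected P t y (sym y-in))

    through-e⁻¹ : ∀ x y → L P x ≡ L P t → L P y ≢ L P t → L P y ≡ L P u →
      Σ (Path x y) (GoodPath (suc k) L′ s′)
    through-e⁻¹ x y x-in y-out Ly≡Lu =
      P₁ ++ₚ cons e (inj₂ (refl , refl)) P₂ ,
      GoodPath-join P₁ e _ P₂ good₁ good₂ e≡k (proj₁ e-inner) (λ Lx≡Lu → Lu≢Lt (trans (sym Lx≡Lu) x-in)) (L P u)
        (L′-in x-in)
        (λ z same → L′-in (trans same x-in))
        (λ z same → trans (L′-out (λ z-in → Lu≢Lt (trans (sym same) z-in))) same)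
        L′u
        (begin
          pathSum w P₁ xor (w e xor pathSum w P₂)
            ≡⟨ cong₂ (λ p₁ p₂ → p₁ xor (w e xor p₂)) (pathSum≡ good₁) (pathSum≡ good₂) ⟩
          (s P x xor s P t) xor (w e xor (s P u xor s P y))
            ≡⟨ solve 5 (λ x t we u y → (x :+ t) :+ (we :+ (u :+ y)) := (x :+ ((we :+ u) :+ t)) :+ y)
              refl (s P x) (s P t) (w e) (s P u) (s P y) ⟩
          (s P x xor δ) xor s P y
            ≡⟨ cong₂ _xor_ (s′-in x-in) (s′-out y-out) ⟨
          s′ x xor s′ y ∎)
      where
      open ≡-Reasoning
      P₁ = proj₁ (connected P x t x-in)
      good₁ = proj₂ (connected P x t x-in)
      P₂ = proj₁ (connected P u y (sym Ly≡Lu))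
      good₂ = proj₂ (connected P u y (sym Ly≡Lu))

    connected′ : ∀ x y → L′ x ≡ L′ y → Σ (Path x y) (GoodPath (suc k) L′ s′)
    connected′ x y L′x≡L′y = by-sides (L P x ≟ L P t) (L P y ≟ L P t)
      where
      by-sides : Dec (L P x ≡ L P t) → Dec (L P y ≡ L P t) → Σ (Path x y) (GoodPath (suc k) L′ s′)
      by-sides (no x-out) (no y-out) =
        keep-path x y (trans (sym (L′-out x-out)) (trans L′x≡L′y (L′-out y-out)))
          (sym (cong₂ _xor_ (s′-out x-out) (s′-out y-out)))
      by-sides (yes x-in) (yes y-in) =
        keep-path x y (trans x-in (sym y-in))
          (trans (solve 3 (λ x y d → x :+ y := (x :+ d) :+ (y :+ d)) refl (s P x) (s P y) δ)
                 (sym (cong₂ _xor_ (s′-in x-in) (s′-in y-in))))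
      by-sides (no x-out) (yes y-in) =
        through-e x y x-out y-in (trans (sym (L′-out x-out)) (trans L′x≡L′y (L′-in y-in)))
      by-sides (yes x-in) (no y-out) =
        through-e⁻¹ x y x-in y-out (trans (sym (L′-out y-out)) (trans (sym L′x≡L′y) (L′-in x-in)))

    merged : Partial (suc k)
    merged = record { L = L′ ; s = s′ ; consistent = consistent′ ; connected = connected′ }

  module _ (blocking : IsBlockingPair G W a b) where

    -- An inner edge closing an old component with the wrong parity would close an odd cycle avoiding a and b.
    closing-edge-consistent : ∀ {k} (P : Partial k) e → toℕ e ≡ k → InnerEdge e →
      L P (end₁ G e) ≡ L P (end₂ G e) → w e ≡ s P (end₁ G e) xor s P (end₂ G e)
    closing-edge-consistent P e e≡k e-inner Lu≡Lt with w e Bool.≟ s P (end₁ G e) xor s P (end₂ G e)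
    ... | yes w≡ = w≡
    ... | no  w≢ = ⊥-elim ([ avoids a proj₁ , avoids b proj₂ ]′ (proj₂ blocking C odd))
      where
      u = end₁ G e
      t = end₂ G e
      p = proj₁ (connected P t u (sym Lu≡Lt))
      good = proj₂ (connected P t u (sym Lu≡Lt))
      C : Cycle G
      C = closeCycle p e (vertices-unique good) (edges-unique good)
            (All-map (λ (_ , e′<k) e′≡e → <-irrefl (trans (cong toℕ e′≡e) e≡k) e′<k) (edges-in good))
            (inj₁ (refl , refl))
      odd : OddCycle G W C
      odd = Equivalence.from (odd-weight⇔Σ₂ (λ i → w (es C i))) (begin
        Σ₂ (λ i → w (es C i))
          ≡⟨ Σ₂-edgeAt w p e ⟩
        pathSum w p xor w e
          ≡⟨ cong (_xor w e) (pathSum≡ good) ⟩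
        (s P t xor s P u) xor w e
          ≡⟨ ≢⇒xor≡true (λ st+su≡we → w≢ (trans (sym st+su≡we) (xor-comm (s P t) (s P u)))) ⟩
        true ∎)
        where open ≡-Reasoning
      avoids : ∀ c → (∀ {z} → OffPair z → z ≢ c) → PassesThrough C c → ⊥
      avoids c off (i , vi≡c) = off (All-vertexAt p (proj₂ e-inner ∷ inner-off good) i) vi≡c

    extend : ∀ k → k < n → Partial k → Partial (suc k)
    extend k k<n P with InnerEdge? (fromℕ< k<n)
    ... | no ¬inner = extend-keep P (fromℕ< k<n) (toℕ-fromℕ< k<n) (⊥-elim ∘ ¬inner)
    ... | yes inner with L P (end₁ G (fromℕ< k<n)) ≟ L P (end₂ G (fromℕ< k<n))
    ...   | no Lu≢Lt = Merge.merged P (fromℕ< k<n) (toℕ-fromℕ< k<n) inner Lu≢Lt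
    ...   | yes Lu≡Lt = extend-keep P (fromℕ< k<n) (toℕ-fromℕ< k<n)
                          λ _ → Lu≡Lt , closing-edge-consistent P (fromℕ< k<n) (toℕ-fromℕ< k<n) inner Lu≡Lt

    partial : ∀ k → k ≤ n → Partial k
    partial zero    _   = partial₀
    partial (suc k) k<n = extend k k<n (partial k (<⇒≤ k<n))

    signing : Σ (Fin v → Bool) λ s → ∀ e → InnerEdge e → w e ≡ s (end₁ G e) xor s (end₂ G e)
    signing = s final , λ e inner → proj₂ (consistent final e (toℕ<n e) inner)
      where final = partial n ≤-refl

-- From a blocking pair to a template matrix

module _ {v n} (G : Graph v n) where

  Σ₂-incidence : ∀ (g : Fin v → Bool) j → Σ₂ (λ x → g x ∧ incidence G x j) ≡ g (end₁ G j) xor g (end₂ G j)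
  Σ₂-incidence g j = begin
    Σ₂ (λ x → g x ∧ incidence G x j)
      ≡⟨ Σ₂-cong (λ x → ∧-distribˡ-xor (g x) _ _) ⟩
    Σ₂ (λ x → (g x ∧ (x ≡ᵇ end₁ G j)) xor (g x ∧ (x ≡ᵇ end₂ G j)))
      ≡⟨ Σ₂-xor (λ x → g x ∧ (x ≡ᵇ end₁ G j)) _ ⟩
    Σ₂ (λ x → g x ∧ (x ≡ᵇ end₁ G j)) xor Σ₂ (λ x → g x ∧ (x ≡ᵇ end₂ G j))
      ≡⟨ cong₂ _xor_ (trans (Σ₂-cong (λ x → ∧-comm (g x) _)) (Σ₂-δ _ g))
        (trans (Σ₂-cong (λ x → ∧-comm (g x) _)) (Σ₂-δ _ g)) ⟩
    g (end₁ G j) xor g (end₂ G j) ∎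
    where open ≡-Reasoning

  incidence-even : ∀ j → Σ₂ (λ x → incidence G x j) ≡ false
  incidence-even j = Σ₂-incidence (λ _ → true) j

module BlockingMatrix {v n} (G : Graph v n) (W : Subset n) (a b : Fin v) (a≢b : a ≢ b)
                      (s : Fin v → Bool)
                      (signs : ∀ e → Signing.InnerEdge G W a b e → lookup W e ≡ s (end₁ G e) xor s (end₂ G e)) where

  open Signing G W a b using (OffPair; OffPair?; InnerEdge)

  offPair : Fin v → Bool
  offPair x = not (x ≡ᵇ a) ∧ not (x ≡ᵇ b)

  -- Row x₁ is W re-signed by s, so it only meets edges at a or b; row x₂ is the row of a;
  -- row x of R is the row of x, zeroed for x ∈ {a, b}.
  A : Matrix (2 + v) n
  A zero          j = lookup W j xor (s (end₁ G j) xor s (end₂ G j))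
  A (suc zero)    j = incidence G a j
  A (suc (suc x)) j = offPair x ∧ incidence G x j

  E : Matrix (suc v) n
  E = ecMatrix G W

  Ker-E⇒A : ∀ Y → Ker E Y → Ker A Y
  Ker-E⇒A Y Y∈Ker zero = begin
    dot Y (A zero)
      ≡⟨ dot-congʳ Y (λ j → cong (lookup W j xor_) (Σ₂-incidence G s j)) ⟨
    dot Y (λ j → lookup W j xor Σ₂ (λ x → s x ∧ incidence G x j))
      ≡⟨ dot-xor Y (lookup W) _ ⟩
    dot Y (lookup W) xor dot Y (λ j → Σ₂ (λ x → s x ∧ incidence G x j))
      ≡⟨ cong₂ _xor_ (Y∈Ker zero) (dot-Σ₂ Y s (incidence G)) ⟩
    Σ₂ (λ x → s x ∧ colSumᶠ E Y (suc x))
      ≡⟨ Σ₂-zero (λ x → trans (cong (s x ∧_) (Y∈Ker (suc x))) (∧-zeroʳ (s x))) ⟩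
    false ∎
    where open ≡-Reasoning
  Ker-E⇒A Y Y∈Ker (suc zero)    = Y∈Ker (suc a)
  Ker-E⇒A Y Y∈Ker (suc (suc x)) =
    trans (dot-scale Y (incidence G x) (offPair x)) (trans (cong (offPair x ∧_) (Y∈Ker (suc x))) (∧-zeroʳ _))

  incidence-at-b : ∀ j → incidence G b j ≡ A (suc zero) j xor Σ₂ (λ x → A (suc (suc x)) j)
  incidence-at-b j = begin
    incidence G b j
      ≡⟨ xor≡false⇒≡ (trans (sym (Σ₂-remove b (λ x → incidence G x j))) (incidence-even G j)) ⟩
    Σ₂ (remove (λ x → incidence G x j) b)
      ≡⟨ Σ₂-remove a _ ⟩
    remove (λ x → incidence G x j) b a xor Σ₂ (λ x → not (x ≡ᵇ a) ∧ (not (x ≡ᵇ b) ∧ incidence G x j))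
      ≡⟨ cong₂ _xor_ (remove-≢ (λ x → incidence G x j) a≢b)
        (Σ₂-cong (λ x → sym (∧-assoc (not (x ≡ᵇ a)) (not (x ≡ᵇ b)) (incidence G x j)))) ⟩
    A (suc zero) j xor Σ₂ (λ x → A (suc (suc x)) j) ∎
    where open ≡-Reasoning

  Ker-A⇒vertices : ∀ Y → Ker A Y → ∀ x → colSumᶠ E Y (suc x) ≡ false
  Ker-A⇒vertices Y Y∈Ker x with x ≟ a | x ≟ b
  ... | yes refl | _        = Y∈Ker (suc zero)
  ... | no _     | yes refl = begin
    dot Y (incidence G b)
      ≡⟨ dot-congʳ Y incidence-at-b ⟩
    dot Y (λ j → A (suc zero) j xor Σ₂ (λ x → A (suc (suc x)) j))
      ≡⟨ dot-xor Y (A (suc zero)) _ ⟩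
    colSumᶠ A Y (suc zero) xor dot Y (λ j → Σ₂ (λ x → A (suc (suc x)) j))
      ≡⟨ cong₂ _xor_ (Y∈Ker (suc zero)) (dot-Σ₂ Y (λ _ → true) (λ x → A (suc (suc x)))) ⟩
    Σ₂ (λ x → colSumᶠ A Y (suc (suc x)))
      ≡⟨ Σ₂-zero (λ x → Y∈Ker (suc (suc x))) ⟩
    false ∎
    where open ≡-Reasoning
  ... | no x≢a   | no x≢b   =
    trans (dot-congʳ Y (λ j → cong (_∧ incidence G x j) (sym off))) (Y∈Ker (suc (suc x)))
    where
    off : offPair x ≡ true
    off rewrite ≢⇒≡ᵇ-false x≢a | ≢⇒≡ᵇ-false x≢b = refl

  Ker-A⇒E : ∀ Y → Ker A Y → Ker E Y
  Ker-A⇒E Y Y∈Ker zero = begin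
    dot Y (lookup W)
      ≡⟨ dot-congʳ Y W≡ ⟩
    dot Y (λ j → A zero j xor Σ₂ (λ x → s x ∧ incidence G x j))
      ≡⟨ dot-xor Y (A zero) _ ⟩
    colSumᶠ A Y zero xor dot Y (λ j → Σ₂ (λ x → s x ∧ incidence G x j))
      ≡⟨ cong₂ _xor_ (Y∈Ker zero) (dot-Σ₂ Y s (incidence G)) ⟩
    Σ₂ (λ x → s x ∧ colSumᶠ E Y (suc x))
      ≡⟨ Σ₂-zero (λ x → trans (cong (s x ∧_) (Ker-A⇒vertices Y Y∈Ker x)) (∧-zeroʳ (s x))) ⟩
    false ∎
    where
    open ≡-Reasoning
    W≡ : ∀ j → lookup W j ≡ A zero j xor Σ₂ (λ x → s x ∧ incidence G x j)
    W≡ j rewrite Σ₂-incidence G s j =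
      solve 2 (λ w d → w := (w :+ d) :+ d) refl (lookup W j) (s (end₁ G j) xor s (end₂ G j))
  Ker-A⇒E Y Y∈Ker (suc x) = Ker-A⇒vertices Y Y∈Ker x

  R-support : ∀ j i → rowsR A j i ≡ true → OffPair i × (i ≡ end₁ G j ⊎ i ≡ end₂ G j)
  R-support j i e with i ≟ a | i ≟ b
  ... | no i≢a | no i≢b = (i≢a , i≢b) , Sum.map ≡ᵇ⇒≡ ≡ᵇ⇒≡ (xor≡true⁻ e)

  EndAtPair : Fin n → Set
  EndAtPair j = ¬ OffPair (end₁ G j) ⊎ ¬ OffPair (end₂ G j)

  R-AtMostTwo : ∀ j → AtMostTwo (rowsR A j)
  R-AtMostTwo j = AtMostTwo-∪ (≡ᵇ-AtMostOne (end₁ G j)) (≡ᵇ-AtMostOne (end₂ G j))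
                    λ i e → Sum.map ≡⇒≡ᵇ ≡⇒≡ᵇ (proj₂ (R-support j i e))

  EndAtPair⇒R-AtMostOne : ∀ j → EndAtPair j → AtMostOne (rowsR A j)
  EndAtPair⇒R-AtMostOne j (inj₁ ¬off₁) = ⊆-single⇒AtMostOne (end₂ G j) λ i e → case R-support j i e of λ where
    (off , inj₁ refl) → ⊥-elim (¬off₁ off)
    (_   , inj₂ i≡e₂) → i≡e₂
  EndAtPair⇒R-AtMostOne j (inj₂ ¬off₂) = ⊆-single⇒AtMostOne (end₁ G j) λ i e → case R-support j i e of λ where
    (_   , inj₁ i≡e₁) → i≡e₁
    (off , inj₂ refl) → ⊥-elim (¬off₂ off)

  x₁⇒EndAtPair : ∀ j → A zero j ≡ true → EndAtPair j
  x₁⇒EndAtPair j A₀≡1 with Signing.OffPair? G W a b (end₁ G j) | Signing.OffPair? G W a b (end₂ G j)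
  ... | no ¬off₁ | _        = inj₁ ¬off₁
  ... | yes _    | no ¬off₂ = inj₂ ¬off₂
  ... | yes off₁ | yes off₂ = ⊥-elim (true≢false (begin
    true
      ≡⟨ A₀≡1 ⟨
    lookup W j xor (s (end₁ G j) xor s (end₂ G j))
      ≡⟨ cong (_xor _) (signs j (off₁ , off₂)) ⟩
    (s (end₁ G j) xor s (end₂ G j)) xor (s (end₁ G j) xor s (end₂ G j))
      ≡⟨ xor-same (s (end₁ G j) xor s (end₂ G j)) ⟩
    false ∎))
    where open ≡-Reasoning

  x₂⇒EndAtPair : ∀ j → A (suc zero) j ≡ true → EndAtPair j
  x₂⇒EndAtPair j A₁≡1 = Sum.map (λ a≡e₁ off → proj₁ off (sym (≡ᵇ⇒≡ a≡e₁)))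
                                (λ a≡e₂ off → proj₁ off (sym (≡ᵇ⇒≡ a≡e₂))) (xor≡true⁻ A₁≡1)

  conforms : ∀ j → Conforms A j
  conforms j = Bool-cases (A zero j)
    (λ A₀≡1 → template-AtMostOne _ _ (EndAtPair⇒R-AtMostOne j (x₁⇒EndAtPair j A₀≡1)))
    λ A₀≡0 → Bool-cases (A (suc zero) j)
      (λ A₁≡1 → template-AtMostOne _ _ (EndAtPair⇒R-AtMostOne j (x₂⇒EndAtPair j A₁≡1)))
      λ A₁≡0 → inj₁ (A₀≡0 , A₁≡0 , R-AtMostTwo j)

ecr⇒template : ∀ {n} (M : Matroid n) → HasECRWithBlockingPair M → InMvΦY1 M
ecr⇒template M (v , G , W , (a , b , blocking) , M≅E) =
  v , A , ⇒conforms A conforms , sameKer⇒iso {M = M} E A Ker-E⇒A Ker-A⇒E M≅E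
  where
  signing = Signing.signing G W a b blocking
  open BlockingMatrix G W a b (proj₁ blocking) (proj₁ signing) (proj₂ signing)

lemma4p5 : (∀ {n : ℕ} (M : Matroid n) → InMvΦY1 M ⇔ (IsBinary M × HasECRWithBlockingPair M))
    × (∀ {m n : ℕ} (N : Matroid m) (M : Matroid n) → IsMinorOf N M → InMvΦY1 M → InMvΦY1 N)
lemma4p5 = (λ M → mk⇔ (template⇒ecr M) (ecr⇒template M ∘ proj₂)) , minor-closed
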